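{- Let $n,s,k$ be integers with $k\geq 2$, $s\geq 3$ and $n\geq sk+1$. Then the automorphism group of the graph $G(n,k,s)$ is the dihedral group $D_{2n}$ (acting naturally on $[n]$ viewed as the vertices of an $n$-cycle).
   Context: Let $[n]=\{1,\dots,n\}$. A subset $S\subseteq[n]$ is $s$-stable if for all distinct $i,j\in S$ we have $s\leq |i-j|\leq n-s$. $[n]^k_s$ denotes the family of $s$-stable $k$-element subsets of $[n]$. The graph $G(n,k,s)$ has vertex set $[n]$, and two distinct vertices $i,j$ are adjacent iff there is no $S\in[n]^k_s$ with $\{i,j\}\subseteq S$. $D_{2n}$ denotes the dihedral group of order $2n$, i.e. the group of permutations of $[n]$ generated by $i\mapsto i+1$ and $i\mapsto -i$ (arithmetic modulo $n$, with $n$ representing $0$). -}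

module Defs where

open import Data.Nat using (ℕ; zero; suc; _+_; _∸_; _≤_; ∣_-_∣)
open import Data.Nat.DivMod using (_mod_)
open import Data.Fin using (Fin; toℕ)
open import Data.Fin.Subset using (Subset; _∈_; ∣_∣)
open import Data.Fin.Permutation using (Permutation′; _⟨$⟩ʳ_)
open import Data.Product using (Σ; _×_; ∃-syntax)
open import Relation.Binary.PropositionalEquality using (_≡_; _≢_)
open import Relation.Nullary using (¬_)
open import Function using (_∘_; id)
open import Function.Bundles using (_⇔_)

-- Vertices [n] = {1,…,n} are represented by Fin n = {0,…,n-1}
-- (i ↦ i-1); differences |i - j| are unchanged, and n ≡ 0 mod n.

Stable : (n s : ℕ) → Subset n → Set
Stable n s S = ∀ (i j : Fin n) → i ∈ S → j ∈ S → i ≢ j →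
  (s ≤ ∣ toℕ i - toℕ j ∣) × (∣ toℕ i - toℕ j ∣ ≤ n ∸ s)

InStableFamily : (n k s : ℕ) → Subset n → Set
InStableFamily n k s S = (∣ S ∣ ≡ k) × Stable n s S

Adj : (n k s : ℕ) → Fin n → Fin n → Set
Adj n k s i j = (i ≢ j) ×
  ¬ (Σ (Subset n) λ S → InStableFamily n k s S × i ∈ S × j ∈ S)

IsAutomorphism : (n k s : ℕ) → Permutation′ n → Set
IsAutomorphism n k s σ =
  ∀ (i j : Fin n) → Adj n k s i j ⇔ Adj n k s (σ ⟨$⟩ʳ i) (σ ⟨$⟩ʳ j)

rot : {n : ℕ} → Fin n → Fin n
rot {suc m} i = suc (toℕ i) mod (suc m)

refl′ : {n : ℕ} → Fin n → Fin n
refl′ {suc m} i = (suc m ∸ toℕ i) mod (suc m)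

-- Since the
-- group is finite, closure under composition with the generators
-- starting from the identity yields the generated subgroup.
data Dihedral (n : ℕ) : (Fin n → Fin n) → Set where
  d-id  : Dihedral n id
  d-rot : ∀ {f} → Dihedral n f → Dihedral n (rot ∘ f)
  d-ref : ∀ {f} → Dihedral n f → Dihedral n (refl′ ∘ f)
  d-ext : ∀ {f g} → Dihedral n f → (∀ i → f i ≡ g i) → Dihedral n g

-- Two vertices at cyclic distance d lie in a common s-stable k-set iff a·s ≤ d and b·s ≤ n - d
-- for some a, b ≥ 1 with a + b = k: an arc of length L holds at most L / s points of a stable
-- set, and two arithmetic progressions of step s realise the bound. So adjacency depends only on
-- cyclic distance, and the dihedral group acts by automorphisms. Conversely, an edge {u, v} of
-- G(n,k,s) joins neighbours on the n-cycle iff N[u] ∖ N[v] is independent; being a graph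
-- property, this is preserved by automorphisms, so every automorphism preserves the n-cycle and
-- is therefore dihedral.
module Submission where

open import Defs
open import Data.Nat using (ℕ; zero; suc; _+_; _*_; _∸_; _≤_; _<_; z≤n; s≤s; ∣_-_∣; _<?_; _≤?_; _≟_; _%_; _/_; NonZero)
open import Data.Nat.Properties
open import Data.Nat.DivMod using (m<n⇒m%n≡m; n%n≡0; m%n<n; [m+n]%n≡m%n; %-distribˡ-+; m%n%n≡m%n; m≡m%n+[m/n]*n)
open import Data.Nat.Tactic.RingSolver using (solve-∀)
open import Data.Bool using (Bool; true; false)
open import Data.Fin as F using (Fin; toℕ; fromℕ<)
import Data.Fin.Properties as FP
open import Data.Fin.Subset using (Subset; _∈_; ∣_∣)
open import Data.Fin.Permutation using (Permutation′; _⟨$⟩ʳ_; _⟨$⟩ˡ_; inverseˡ; inverseʳ)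
open import Data.Vec using ([]; _∷_; tabulate)
open import Data.Vec.Base using (here; there)
open import Data.Product using (Σ; ∃; _×_; _,_; proj₁; proj₂)
open import Data.Sum using (_⊎_; inj₁; inj₂; [_,_]′)
open import Data.Empty using (⊥-elim)
open import Relation.Nullary using (¬_; Dec; yes; no)
open import Relation.Binary.Definitions using (tri<; tri≈; tri>)
open import Relation.Binary.PropositionalEquality hiding (J)
open import Function using (_∘_; id)
open import Function.Bundles using (_⇔_; mk⇔; Equivalence)

-- Counting marked points

bit : Bool → ℕ
bit true = 1
bit false = 0

count : (ℕ → Bool) → ℕ → ℕ → ℕ
count f lo zero = 0
count f lo (suc L) = bit (f lo) + count f (suc lo) L

count-+ : ∀ f lo a b → count f lo (a + b) ≡ count f lo a + count f (lo + a) b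
count-+ f lo zero b = cong (λ z → count f z b) (sym (+-identityʳ lo))
count-+ f lo (suc a) b = begin
  bit (f lo) + count f (suc lo) (a + b)                     ≡⟨ cong (bit (f lo) +_) (count-+ f (suc lo) a b) ⟩
  bit (f lo) + (count f (suc lo) a + count f (suc lo + a) b) ≡⟨ sym (+-assoc (bit (f lo)) _ _) ⟩
  bit (f lo) + count f (suc lo) a + count f (suc lo + a) b   ≡⟨ cong (λ z → bit (f lo) + count f (suc lo) a + count f z b) (sym (+-suc lo a)) ⟩
  bit (f lo) + count f (suc lo) a + count f (lo + suc a) b   ∎
  where open ≡-Reasoning

count-cong : ∀ f g lo lo' L → (∀ t → t < L → f (lo + t) ≡ g (lo' + t)) → count f lo L ≡ count g lo' L
count-cong f g lo lo' zero h = refl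
count-cong f g lo lo' (suc L) h = cong₂ _+_ head (count-cong f g (suc lo) (suc lo') L tail)
  where
  head : bit (f lo) ≡ bit (g lo')
  head = cong bit (subst₂ (λ x y → f x ≡ g y) (+-identityʳ lo) (+-identityʳ lo') (h 0 (s≤s z≤n)))
  tail : ∀ t → t < L → f (suc lo + t) ≡ g (suc lo' + t)
  tail t p = subst₂ (λ x y → f x ≡ g y) (+-suc lo t) (+-suc lo' t) (h (suc t) (s≤s p))

count-none : ∀ f lo L → (∀ t → t < L → f (lo + t) ≡ false) → count f lo L ≡ 0
count-none f lo zero h = refl
count-none f lo (suc L) h = cong₂ _+_ (cong bit (subst (λ x → f x ≡ false) (+-identityʳ lo) (h 0 (s≤s z≤n))))
  (count-none f (suc lo) L (λ t t<L → subst (λ x → f x ≡ false) (+-suc lo t) (h (suc t) (s≤s t<L))))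

count-pos : ∀ f lo L → 1 ≤ L → f lo ≡ true → 1 ≤ count f lo L
count-pos f lo (suc L) _ e rewrite e = s≤s z≤n

record Spaced (s : ℕ) (Q : ℕ → Bool) (lo L : ℕ) : Set where
  field
    before-end : ∀ {t} → t < L → Q (lo + t) ≡ true → t + s ≤ L
    apart : ∀ {t u} → t < u → u < L → Q (lo + t) ≡ true → Q (lo + u) ≡ true → t + s ≤ u

Spaced-suc : ∀ {s Q lo L} → Spaced s Q lo (suc L) → Spaced s Q (suc lo) L
Spaced-suc {s} {Q} {lo} sp = record
  { before-end = λ {t} t<L q → ≤-pred (before-end (s≤s t<L) (reindex t q))
  ; apart = λ {t} {u} t<u u<L qt qu → ≤-pred (apart (s≤s t<u) (s≤s u<L) (reindex t qt) (reindex u qu))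
  }
  where
  open Spaced sp
  reindex : ∀ t → Q (suc lo + t) ≡ true → Q (lo + suc t) ≡ true
  reindex t = subst (λ x → Q x ≡ true) (sym (+-suc lo t))

Spaced-drop : ∀ {s Q lo R} → Spaced s Q lo (s + R) → Spaced s Q (lo + s) R
Spaced-drop {s} {Q} {lo} {R} sp = record
  { before-end = λ {t} t<R q → +-cancelˡ-≤ s (t + s) R
      (subst (_≤ s + R) (+-assoc s t s) (before-end (+-monoʳ-< s t<R) (reindex t q)))
  ; apart = λ {t} {u} t<u u<R qt qu → +-cancelˡ-≤ s (t + s) u
      (subst (_≤ s + u) (+-assoc s t s) (apart (+-monoʳ-< s t<u) (+-monoʳ-< s u<R) (reindex t qt) (reindex u qu)))
  }
  where
  open Spaced sp
  reindex : ∀ t → Q (lo + s + t) ≡ true → Q (lo + (s + t)) ≡ true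
  reindex t = subst (λ x → Q x ≡ true) (+-assoc lo s t)

Spaced-first-block : ∀ {s' Q lo R} → Spaced (suc s') Q lo (suc s' + R) → Q lo ≡ true → count Q lo (suc s') ≡ 1
Spaced-first-block {s'} {Q} {lo} {R} sp Q-lo = cong₂ _+_ (cong bit Q-lo) (count-none Q (suc lo) s' unmarked)
  where
  open Spaced sp
  Q-lo+0 : Q (lo + 0) ≡ true
  Q-lo+0 = trans (cong Q (+-identityʳ lo)) Q-lo
  unmarked : ∀ t → t < s' → Q (suc lo + t) ≡ false
  unmarked t t<s' with Q (suc lo + t) in eq
  ... | false = refl
  ... | true = ⊥-elim (<⇒≱ (s≤s t<s') (apart (s≤s z≤n) (≤-trans (s≤s t<s') (m≤m+n (suc s') R))
                                               Q-lo+0 (trans (cong Q (+-suc lo t)) eq)))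

count-spaced : ∀ s Q lo L → Spaced s Q lo L → count Q lo L * s ≤ L
count-spaced zero Q lo L _ = subst (_≤ L) (sym (*-zeroʳ (count Q lo L))) z≤n
count-spaced (suc s') Q lo L = go L ≤-refl
  where
  s : ℕ
  s = suc s'
  go : ∀ fuel {lo L} → L ≤ fuel → Spaced s Q lo L → count Q lo L * s ≤ L
  go _ {L = zero} _ _ = z≤n
  go (suc fuel) {lo} {suc L} (s≤s L≤fuel) sp with Q lo in eq
  ... | false = ≤-trans (go fuel L≤fuel (Spaced-suc sp)) (n≤1+n L)
  ... | true = subst (λ b → (bit b + count Q (suc lo) L) * s ≤ suc L) eq marked
    where
    marked : count Q lo (suc L) * s ≤ suc L
    marked with m≤n⇒∃[o]m+o≡n (Spaced.before-end sp (s≤s z≤n) (trans (cong Q (+-identityʳ lo)) eq))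
    ... | R , refl = begin
      count Q lo (s + R) * s                       ≡⟨ cong (_* s) (count-+ Q lo s R) ⟩
      (count Q lo s + count Q (lo + s) R) * s      ≡⟨ cong (λ c → (c + count Q (lo + s) R) * s) (Spaced-first-block sp eq) ⟩
      s + count Q (lo + s) R * s                   ≤⟨ +-monoʳ-≤ s (go fuel (≤-trans (m≤n+m R s') L≤fuel) (Spaced-drop sp)) ⟩
      s + R                                        ∎
      where open ≤-Reasoning

indicator : ∀ {n} → Subset n → ℕ → Bool
indicator [] x = false
indicator (b ∷ p) zero = b
indicator (b ∷ p) (suc x) = indicator p x

∣∣≡count-indicator : ∀ {n} (p : Subset n) → ∣ p ∣ ≡ count (indicator p) 0 n
∣∣≡count-indicator [] = refl
∣∣≡count-indicator {suc n} (true ∷ p) = cong suc (trans (∣∣≡count-indicator p) (count-cong _ _ 0 1 n (λ t _ → refl)))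
∣∣≡count-indicator {suc n} (false ∷ p) = trans (∣∣≡count-indicator p) (count-cong _ _ 0 1 n (λ t _ → refl))

∈⇒indicator : ∀ {n} (p : Subset n) (x : Fin n) → x ∈ p → indicator p (toℕ x) ≡ true
∈⇒indicator (b ∷ p) F.zero here = refl
∈⇒indicator (b ∷ p) (F.suc x) (there q) = ∈⇒indicator p x q

indicator⇒∈ : ∀ {n} (p : Subset n) (x : Fin n) → indicator p (toℕ x) ≡ true → x ∈ p
indicator⇒∈ (true ∷ p) F.zero e = here
indicator⇒∈ (b ∷ p) (F.suc x) e = there (indicator⇒∈ p x e)

indicator-tabulate : ∀ n (h : ℕ → Bool) y → y < n → indicator (tabulate {n = n} (h ∘ toℕ)) y ≡ h y
indicator-tabulate (suc n) h zero _ = refl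
indicator-tabulate (suc n) h (suc y) (s≤s p) = indicator-tabulate n (h ∘ suc) y p

∣tabulate∣≡count : ∀ n (h : ℕ → Bool) → ∣ tabulate {n = n} (h ∘ toℕ) ∣ ≡ count h 0 n
∣tabulate∣≡count n h = trans (∣∣≡count-indicator (tabulate {n = n} (h ∘ toℕ)))
                             (count-cong _ _ 0 0 n (λ t p → indicator-tabulate n h t p))

∈tabulate⇔ : ∀ n (h : ℕ → Bool) (x : Fin n) → x ∈ tabulate {n = n} (h ∘ toℕ) ⇔ (h (toℕ x) ≡ true)
∈tabulate⇔ n h x = mk⇔
  (λ q → trans (sym (indicator-tabulate n h (toℕ x) (FP.toℕ<n x))) (∈⇒indicator _ x q))
  (λ e → indicator⇒∈ _ x (trans (indicator-tabulate n h (toℕ x) (FP.toℕ<n x)) e))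

-- Stable sets and admissible distances

-- a of the k points lie on the arc of length d starting at the first point, b on the other arc
record Admissible (n s k d : ℕ) : Set where
  constructor mkAdmissible
  field
    a b : ℕ
    a≥1 : 1 ≤ a
    b≥1 : 1 ≤ b
    a+b≡k : a + b ≡ k
    a*s≤d : a * s ≤ d
    d+b*s≤n : d + b * s ≤ n

CyclicallySpaced : (n s : ℕ) → (ℕ → Bool) → Set
CyclicallySpaced n s χ = ∀ p q → p < q → q < n → χ p ≡ true → χ q ≡ true → (p + s ≤ q) × (q + s ≤ p + n)

-- χ on [0, n) repeated on [n, 2n), turning the arc that crosses 0 into a window
unroll : ℕ → (ℕ → Bool) → ℕ → Bool
unroll n χ y with y <? n
... | yes _ = χ y
... | no _ = χ (y ∸ n)

unroll-< : ∀ n χ y → y < n → unroll n χ y ≡ χ y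
unroll-< n χ y lt with y <? n
... | yes _ = refl
... | no ¬p = ⊥-elim (¬p lt)

unroll-+ : ∀ n χ t → unroll n χ (n + t) ≡ χ t
unroll-+ n χ t with (n + t) <? n
... | yes p = ⊥-elim (<⇒≱ p (m≤m+n n t))
... | no _ = cong χ (m+n∸m≡n n t)

module Necessity {n s : ℕ} {χ : ℕ → Bool} (spaced : CyclicallySpaced n s χ)
  {I d e : ℕ} (I+d+e≡n : I + d + e ≡ n) (d≥1 : 1 ≤ d) (e≥1 : 1 ≤ e)
  (χI : χ I ≡ true) (χJ : χ (I + d) ≡ true) where

  private
    J : ℕ
    J = I + d
    Q : ℕ → Bool
    Q = unroll n χ

    J<n : J < n
    J<n = subst (J <_) I+d+e≡n (subst (_≤ J + e) (+-comm J 1) (+-monoʳ-≤ J e≥1))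

    I<J : I < J
    I<J = subst (_≤ J) (+-comm I 1) (+-monoʳ-≤ I d≥1)

    Q-< : ∀ {t} → t < e → Q (J + t) ≡ χ (J + t)
    Q-< {t} te = unroll-< n χ (J + t) (subst (J + t <_) I+d+e≡n (+-monoʳ-< J te))

    Q-wrap : ∀ t → Q (J + (e + t)) ≡ χ t
    Q-wrap t = trans (cong Q (trans (sym (+-assoc J e t)) (cong (_+ t) I+d+e≡n))) (unroll-+ n χ t)

  inner-arc : count χ I d * s ≤ d
  inner-arc = count-spaced s χ I d (record { before-end = before-end ; apart = apart })
    where
    before-end : ∀ {t} → t < d → χ (I + t) ≡ true → t + s ≤ d
    before-end {t} td q = +-cancelˡ-≤ I (t + s) d (subst (_≤ J) (+-assoc I t s)
                 (proj₁ (spaced (I + t) J (+-monoʳ-< I td) J<n q χJ)))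
    apart : ∀ {t u} → t < u → u < d → χ (I + t) ≡ true → χ (I + u) ≡ true → t + s ≤ u
    apart {t} {u} tu ud qt qu = +-cancelˡ-≤ I (t + s) u (subst (_≤ I + u) (+-assoc I t s)
                 (proj₁ (spaced (I + t) (I + u) (+-monoʳ-< I tu) (<-trans (+-monoʳ-< I ud) J<n) qt qu)))

  private
    outer-before-end : ∀ {t} → t < e + I → Q (J + t) ≡ true → t + s ≤ e + I
    outer-before-end {t} tL q with t <? e
    ... | yes te = +-cancelˡ-≤ J (t + s) (e + I)
                     (subst₂ _≤_ (+-assoc J t s) (lem I d e) (subst (λ z → J + t + s ≤ I + z) (sym I+d+e≡n) r))
      where
      r : J + t + s ≤ I + n
      r = proj₂ (spaced I (J + t) (≤-trans I<J (m≤m+n J t)) (subst (J + t <_) I+d+e≡n (+-monoʳ-< J te))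
                  χI (trans (sym (Q-< te)) q))
      lem : ∀ I d e → I + (I + d + e) ≡ I + d + (e + I)
      lem = solve-∀
    ... | no te with m≤n⇒∃[o]m+o≡n (≮⇒≥ te)
    ...   | t' , refl = subst (_≤ e + I) (sym (+-assoc e t' s)) (+-monoʳ-≤ e
              (proj₁ (spaced t' I (+-cancelˡ-< e t' I tL) (<-trans I<J J<n) (trans (sym (Q-wrap t')) q) χI)))
    outer-apart : ∀ {t u} → t < u → u < e + I → Q (J + t) ≡ true → Q (J + u) ≡ true → t + s ≤ u
    outer-apart {t} {u} tu uL qt qu with u <? e
    ... | yes ue = +-cancelˡ-≤ J (t + s) u (subst (_≤ J + u) (+-assoc J t s)
          (proj₁ (spaced (J + t) (J + u) (+-monoʳ-< J tu) Ju<n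
             (trans (sym (Q-< (<-trans tu ue))) qt) (trans (sym (Q-< ue)) qu))))
      where
      Ju<n : J + u < n
      Ju<n = subst (J + u <_) I+d+e≡n (+-monoʳ-< J ue)
    ... | no ue with m≤n⇒∃[o]m+o≡n (≮⇒≥ ue)
    ...   | u' , refl = second (t <? e)
      where
      u'<I : u' < I
      u'<I = +-cancelˡ-< e u' I uL
      qu' : χ u' ≡ true
      qu' = trans (sym (Q-wrap u')) qu
      second : Dec (t < e) → t + s ≤ e + u'
      second (yes te) = +-cancelˡ-≤ J (t + s) (e + u')
          (subst₂ _≤_ (+-assoc J t s) (lem J e u') (subst (λ z → J + t + s ≤ u' + z) (sym I+d+e≡n) r))
        where
        Jt<n : J + t < n
        Jt<n = subst (J + t <_) I+d+e≡n (+-monoʳ-< J te)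
        r : J + t + s ≤ u' + n
        r = proj₂ (spaced u' (J + t) (≤-trans (<-trans u'<I I<J) (m≤m+n J t)) Jt<n qu' (trans (sym (Q-< te)) qt))
        lem : ∀ J e u → u + (J + e) ≡ J + (e + u)
        lem = solve-∀
      second (no te) with m≤n⇒∃[o]m+o≡n (≮⇒≥ te)
      ... | t' , refl = subst (_≤ e + u') (sym (+-assoc e t' s)) (+-monoʳ-≤ e
             (proj₁ (spaced t' u' (+-cancelˡ-< e t' u' tu) (<-trans u'<I (<-trans I<J J<n))
                       (trans (sym (Q-wrap t')) qt) qu')))

  outer-arc : count Q J (e + I) * s ≤ e + I
  outer-arc = count-spaced s Q J (e + I) (record { before-end = outer-before-end ; apart = outer-apart })

  admissible : ∀ {k} → count χ 0 n ≡ k → Admissible n s k d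
  admissible {k} count≡k = mkAdmissible a b a≥1 b≥1 a+b≡k inner-arc d+b*s≤n
    where
    a : ℕ
    a = count χ I d
    b : ℕ
    b = count χ 0 I + count χ J e
    a+b≡k : a + b ≡ k
    a+b≡k = begin
      a + (count χ 0 I + count χ J e) ≡⟨ lem (count χ 0 I) a (count χ J e) ⟩
      count χ 0 I + a + count χ J e   ≡⟨ cong (_+ count χ J e) (sym (count-+ χ 0 I d)) ⟩
      count χ 0 J + count χ J e       ≡⟨ sym (count-+ χ 0 J e) ⟩
      count χ 0 (J + e)               ≡⟨ cong (count χ 0) I+d+e≡n ⟩
      count χ 0 n                     ≡⟨ count≡k ⟩
      k                               ∎
      where
      open ≡-Reasoning
      lem : ∀ x y z → y + (x + z) ≡ x + y + z
      lem = solve-∀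
    a≥1 : 1 ≤ a
    a≥1 = count-pos χ I d d≥1 χI
    b≥1 : 1 ≤ b
    b≥1 = ≤-trans (count-pos χ J e e≥1 χJ) (m≤n+m _ (count χ 0 I))
    count-outer : count Q J (e + I) ≡ b
    count-outer = trans (count-+ Q J e I) (trans (cong₂ _+_
        (count-cong Q χ J J e (λ t te → Q-< te))
        (count-cong Q χ (J + e) 0 I (λ t _ → trans (cong Q (+-assoc J e t)) (Q-wrap t))))
      (+-comm (count χ J e) (count χ 0 I)))
    d+b*s≤n : d + b * s ≤ n
    d+b*s≤n = subst (d + b * s ≤_) (trans (lem I d e) I+d+e≡n)
             (+-monoʳ-≤ d (subst (λ z → z * s ≤ e + I) count-outer outer-arc))
      where
      lem : ∀ I d e → d + (e + I) ≡ I + d + e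
      lem = solve-∀

-- Distances on the n-cycle

∣m+n-m∣≡n : ∀ m n → ∣ m + n - m ∣ ≡ n
∣m+n-m∣≡n m n = trans (∣-∣-comm (m + n) m) (∣m-m+n∣≡n m n)

-- two linear distances d, d' < n that give the same distance on the n-cycle
SameCycDist : ℕ → ℕ → ℕ → Set
SameCycDist n d' d = (d' ≡ d) ⊎ (d' + d ≡ n)

SameCycDist-trans : ∀ {n a b c} → SameCycDist n a b → SameCycDist n b c → SameCycDist n a c
SameCycDist-trans (inj₁ refl) b~c = b~c
SameCycDist-trans (inj₂ a+b≡n) (inj₁ refl) = inj₂ a+b≡n
SameCycDist-trans {a = a} {b} {c} (inj₂ a+b≡n) (inj₂ b+c≡n) =
  inj₁ (+-cancelʳ-≡ b a c (trans a+b≡n (sym (trans (+-comm c b) b+c≡n))))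

SameCycDist-sym : ∀ {n a b} → SameCycDist n a b → SameCycDist n b a
SameCycDist-sym (inj₁ refl) = inj₁ refl
SameCycDist-sym {a = a} {b} (inj₂ a+b≡n) = inj₂ (trans (+-comm b a) a+b≡n)

dist : ∀ {n} → Fin n → Fin n → ℕ
dist x y = ∣ toℕ x - toℕ y ∣

dist<n : ∀ {n} (x y : Fin n) → dist x y < n
dist<n x y with ∣m-n∣≡[m∸n]∨[n∸m] (toℕ x) (toℕ y)
... | inj₁ e = subst (_< _) (sym e) (≤-<-trans (m∸n≤m (toℕ x) (toℕ y)) (FP.toℕ<n x))
... | inj₂ e = subst (_< _) (sym e) (≤-<-trans (m∸n≤m (toℕ y) (toℕ x)) (FP.toℕ<n y))

PreservesCycDist : ∀ {n} → (Fin n → Fin n) → Set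
PreservesCycDist {n} f = ∀ x y → SameCycDist n (dist (f x) (f y)) (dist x y)

PreservesCycDist⇒injective : ∀ {n} {f : Fin n → Fin n} → PreservesCycDist f → ∀ {x y} → f x ≡ f y → x ≡ y
PreservesCycDist⇒injective {n} {f} pres {x} {y} fx≡fy = resolve (pres x y)
  where
  dist-fx-fy≡0 : dist (f x) (f y) ≡ 0
  dist-fx-fy≡0 = trans (cong (λ z → dist z (f y)) fx≡fy) (∣n-n∣≡0 (toℕ (f y)))
  resolve : SameCycDist n (dist (f x) (f y)) (dist x y) → x ≡ y
  resolve (inj₁ e) = FP.toℕ-injective (∣m-n∣≡0⇒m≡n (trans (sym e) dist-fx-fy≡0))
  resolve (inj₂ e) = ⊥-elim (<-irrefl (trans (cong (_+ dist x y) (sym dist-fx-fy≡0)) e) (dist<n x y))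

module Shift (n : ℕ) where

  shift : ℕ → ℕ → ℕ
  shift c y with y + c <? n
  ... | yes _ = y + c
  ... | no _ = y + c ∸ n

  shift-< : ∀ c y → y + c < n → shift c y ≡ y + c
  shift-< c y lt with y + c <? n
  ... | yes _ = refl
  ... | no ¬p = ⊥-elim (¬p lt)

  shift-wrap : ∀ c y z → n + z ≡ y + c → shift c y ≡ z
  shift-wrap c y z eq with y + c <? n
  ... | yes p = ⊥-elim (<⇒≱ p (subst (n ≤_) eq (m≤m+n n z)))
  ... | no _ = trans (cong (_∸ n) (sym eq)) (m+n∸m≡n n z)

  shift-cases : ∀ c y → (y + c < n × shift c y ≡ y + c) ⊎ (∃ λ z → n + z ≡ y + c × shift c y ≡ z)
  shift-cases c y with y + c <? n
  ... | yes p = inj₁ (p , refl)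
  ... | no ¬p with m≤n⇒∃[o]m+o≡n (≮⇒≥ ¬p)
  ...   | z , eq = inj₂ (z , eq , trans (cong (_∸ n) (sym eq)) (m+n∸m≡n n z))

  shift<n : ∀ c y → y < n → c ≤ n → shift c y < n
  shift<n c y yn cn with shift-cases c y
  ... | inj₁ (p , e) = subst (_< n) (sym e) p
  ... | inj₂ (z , eq , e) = subst (_< n) (sym e) (+-cancelˡ-< n z n
        (subst (_< n + n) (sym eq) (+-mono-<-≤ yn cn)))

  wrap-distance : ∀ x y c Y → x + c < n → n + Y ≡ y + c → y < n → ∣ (x + c) - Y ∣ + ∣ x - y ∣ ≡ n
  wrap-distance x y c Y xc eqY yn with m≤n⇒∃[o]m+o≡n (≤-trans (<⇒≤ Y<c) (m≤n+m c x))
                                     | m≤n⇒∃[o]m+o≡n (<⇒≤ x<y)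
    where
    Y<c : Y < c
    Y<c = +-cancelˡ-< n Y c (subst (_< n + c) (sym eqY) (+-monoˡ-< c yn))
    x<y : x < y
    x<y = +-cancelʳ-< c x y (<-≤-trans xc (subst (n ≤_) eqY (m≤m+n n Y)))
  ... | A , Y+A≡x+c | B , refl = begin
    ∣ (x + c) - Y ∣ + ∣ x - x + B ∣ ≡⟨ cong₂ _+_ (trans (cong (∣_- Y ∣) (sym Y+A≡x+c)) (∣m+n-m∣≡n Y A))
                                                (∣m-m+n∣≡n x B) ⟩
    A + B                            ≡⟨ sym (+-cancelˡ-≡ Y n (A + B) chain) ⟩
    n                                ∎
    where
    open ≡-Reasoning
    lem : ∀ x B c → x + B + c ≡ x + c + B
    lem = solve-∀
    chain : Y + n ≡ Y + (A + B)
    chain = begin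
      Y + n     ≡⟨ +-comm Y n ⟩
      n + Y     ≡⟨ eqY ⟩
      x + B + c ≡⟨ lem x B c ⟩
      x + c + B ≡⟨ cong (_+ B) (sym Y+A≡x+c) ⟩
      Y + A + B ≡⟨ +-assoc Y A B ⟩
      Y + (A + B) ∎

  shift-distance : ∀ c x y → x < n → y < n → SameCycDist n ∣ shift c x - shift c y ∣ ∣ x - y ∣
  shift-distance c x y xn yn with shift-cases c x | shift-cases c y
  ... | inj₁ (px , ex) | inj₁ (py , ey) = inj₁ (trans (cong₂ ∣_-_∣ ex ey)
          (trans (cong₂ ∣_-_∣ (+-comm x c) (+-comm y c)) (∣m+n-m+o∣≡∣n-o∣ c x y)))
  ... | inj₂ (X , eqX , ex) | inj₂ (Y , eqY , ey) = inj₁ (trans (cong₂ ∣_-_∣ ex ey)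
          (trans (sym (∣m+n-m+o∣≡∣n-o∣ n X Y)) (trans (cong₂ ∣_-_∣ eqX eqY)
             (trans (cong₂ ∣_-_∣ (+-comm x c) (+-comm y c)) (∣m+n-m+o∣≡∣n-o∣ c x y)))))
  ... | inj₁ (px , ex) | inj₂ (Y , eqY , ey) = inj₂ (trans (cong (_+ ∣ x - y ∣) (cong₂ ∣_-_∣ ex ey))
          (wrap-distance x y c Y px eqY yn))
  ... | inj₂ (X , eqX , ex) | inj₁ (py , ey) = inj₂ (trans (cong₂ _+_ (trans (cong₂ ∣_-_∣ ex ey)
          (∣-∣-comm X (y + c))) (∣-∣-comm x y)) (wrap-distance y x c X py eqX xn))

  count-shift : ∀ (f : ℕ → Bool) c → c ≤ n → count (f ∘ shift c) 0 n ≡ count f 0 n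
  count-shift f c cn with m≤n⇒∃[o]m+o≡n cn
  ... | I , c+I≡n = begin
      count g 0 n             ≡⟨ cong (count g 0) (trans (sym c+I≡n) (+-comm c I)) ⟩
      count g 0 (I + c)       ≡⟨ count-+ g 0 I c ⟩
      count g 0 I + count g I c ≡⟨ cong₂ _+_ before after ⟩
      count f c I + count f 0 c ≡⟨ +-comm (count f c I) (count f 0 c) ⟩
      count f 0 c + count f c I ≡⟨ sym (count-+ f 0 c I) ⟩
      count f 0 (c + I)       ≡⟨ cong (count f 0) c+I≡n ⟩
      count f 0 n             ∎
    where
    open ≡-Reasoning
    g : ℕ → Bool
    g = f ∘ shift c
    before : count g 0 I ≡ count f c I
    before = count-cong g f 0 c I (λ t tI → cong f (trans (shift-< c t
            (subst (t + c <_) (trans (+-comm I c) c+I≡n) (+-monoˡ-< c tI))) (+-comm t c)))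
    after : count g I c ≡ count f 0 c
    after = count-cong g f I 0 c (λ t tc → cong f (shift-wrap c (I + t) t (trans (cong (_+ t) (sym c+I≡n)) (lem c I t))))
      where
      lem : ∀ c I t → c + I + t ≡ I + t + c
      lem = solve-∀

  shift≡mod : .{{_ : NonZero n}} → ∀ c y → y < n → c ≤ n → shift c y ≡ (y + c) % n
  shift≡mod c y yn cn with shift-cases c y | shift<n c y yn cn
  ... | inj₁ (lt , e) | _ = trans e (sym (m<n⇒m%n≡m lt))
  ... | inj₂ (z , eq , e) | r<n = trans e (sym (begin
      (y + c) % n ≡⟨ cong (_% n) (trans (sym eq) (+-comm n z)) ⟩
      (z + n) % n ≡⟨ [m+n]%n≡m%n z n ⟩
      z % n       ≡⟨ m<n⇒m%n≡m (subst (_< n) e r<n) ⟩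
      z           ∎))
    where open ≡-Reasoning

StableDistance : ℕ → ℕ → ℕ → Set
StableDistance n s D = (s ≤ D) × (D ≤ n ∸ s)

StableDistance-complement : ∀ {n s D D'} → D + D' ≡ n → StableDistance n s D → StableDistance n s D'
StableDistance-complement {n} {s} {D} {D'} D+D'≡n (s≤D , D≤n∸s) = s≤D' , D'≤n∸s
  where
  s≤n : s ≤ n
  s≤n = subst (s ≤_) D+D'≡n (≤-trans s≤D (m≤m+n D D'))
  s≤D' : s ≤ D'
  s≤D' = +-cancelˡ-≤ D s D' (subst (D + s ≤_) (sym D+D'≡n) (m≤o∸n⇒m+n≤o D s≤n D≤n∸s))
  D'≤n∸s : D' ≤ n ∸ s
  D'≤n∸s = m+n≤o⇒m≤o∸n D' (subst (D' + s ≤_) (trans (+-comm D' D) D+D'≡n) (+-monoʳ-≤ D' s≤D))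

spaced⇒StableDistance : ∀ {n s} p q → p < q → p + s ≤ q → q + s ≤ p + n → StableDistance n s ∣ p - q ∣
spaced⇒StableDistance {n} {s} p q p<q h1 h2 with m≤n⇒∃[o]m+o≡n (<⇒≤ p<q)
... | r , refl = subst (StableDistance n s) (sym (∣m-m+n∣≡n p r))
        (+-cancelˡ-≤ p s r h1 , m+n≤o⇒m≤o∸n r (+-cancelˡ-≤ p (r + s) n (subst (_≤ p + n) (+-assoc p r s) h2)))

module Progression (s' : ℕ) where

  s : ℕ
  s = suc s'

  multiple : ℕ → ℕ → Bool
  multiple zero y = false
  multiple (suc c) zero = true
  multiple (suc c) (suc y) with suc y <? s
  ... | yes _ = false
  ... | no _ = multiple c (suc y ∸ s)

  multiple-0 : ∀ c → 1 ≤ c → multiple c 0 ≡ true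
  multiple-0 (suc c) _ = refl

  multiple-sound : ∀ c y → multiple c y ≡ true → ∃ λ t → t < c × t * s ≡ y
  multiple-sound (suc c) zero e = 0 , s≤s z≤n , refl
  multiple-sound (suc c) (suc y) e with suc y <? s
  multiple-sound (suc c) (suc y) () | yes _
  ... | no ¬p with multiple-sound c (suc y ∸ s) e
  ...   | t , t<c , eq = suc t , s≤s t<c , trans (cong (s +_) eq) (m+[n∸m]≡n (≮⇒≥ ¬p))

  multiple-shift : ∀ c t → multiple (suc c) (s + t) ≡ multiple c t
  multiple-shift c t with suc (s' + t) <? s
  ... | yes p = ⊥-elim (<⇒≱ p (s≤s (m≤m+n s' t)))
  ... | no _ = cong (multiple c) (m+n∸m≡n s t)

  multiple-gap : ∀ c t → t < s' → multiple (suc c) (suc t) ≡ false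
  multiple-gap c t lt with suc t <? s
  ... | yes _ = refl
  ... | no ¬p = ⊥-elim (¬p (s≤s lt))

  count-multiple : ∀ c L → c * s ≤ L → count (multiple c) 0 L ≡ c
  count-multiple zero L _ = count-none (multiple zero) 0 L (λ t _ → refl)
  count-multiple (suc c) L le with m≤n⇒∃[o]m+o≡n (≤-trans (m≤m+n s (c * s)) le)
  ... | R , refl = begin
      count (multiple (suc c)) 0 (s + R)                          ≡⟨ count-+ (multiple (suc c)) 0 s R ⟩
      count (multiple (suc c)) 0 s + count (multiple (suc c)) s R ≡⟨ cong₂ _+_ first rest ⟩
      1 + c                                                       ∎
    where
    open ≡-Reasoning
    first : count (multiple (suc c)) 0 s ≡ 1
    first = cong suc (count-none (multiple (suc c)) 1 s' (λ t lt → multiple-gap c t lt))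
    rest : count (multiple (suc c)) s R ≡ c
    rest = trans (count-cong (multiple (suc c)) (multiple c) s 0 R (λ t _ → multiple-shift c t))
                 (count-multiple c R (+-cancelˡ-≤ s (c * s) R le))

-- The witness set for an admissible distance d: a points s apart starting at 0, then b points
-- s apart starting at d, rotated so that 0 lands on I.
module Construction {n s' k I d : ℕ} (I+d<n : I + d < n) (d≥1 : 1 ≤ d)
  (adm : Admissible n (suc s') k d) where

  open Admissible adm
  open Progression s'
  open Shift n

  private
    d≤n : d ≤ n
    d≤n = ≤-trans (m≤n+m d I) (<⇒≤ I+d<n)

  pattern₀ : ℕ → Bool
  pattern₀ y with y <? d
  ... | yes _ = multiple a y
  ... | no _ = multiple b (y ∸ d)

  pattern₀-< : ∀ y → y < d → pattern₀ y ≡ multiple a y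
  pattern₀-< y lt with y <? d
  ... | yes _ = refl
  ... | no ¬p = ⊥-elim (¬p lt)

  pattern₀-+ : ∀ t → pattern₀ (d + t) ≡ multiple b t
  pattern₀-+ t with (d + t) <? d
  ... | yes p = ⊥-elim (<⇒≱ p (m≤m+n d t))
  ... | no _ = cong (multiple b) (m+n∸m≡n d t)

  data Point (p : ℕ) : Set where
    first : ∀ t → t < a → t * s ≡ p → Point p
    second : ∀ t → t < b → d + t * s ≡ p → Point p

  pattern₀-point : ∀ p → pattern₀ p ≡ true → Point p
  pattern₀-point p e with p <? d
  ... | yes lt with multiple-sound a p e
  ...   | t , ta , eq = first t ta eq
  pattern₀-point p e | no ¬p with m≤n⇒∃[o]m+o≡n (≮⇒≥ ¬p)
  ...   | r , refl with multiple-sound b (d + r ∸ d) e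
  ...     | t , tb , eq = second t tb (trans (cong (d +_) eq) (m+[n∸m]≡n (m≤m+n d r)))

  count-pattern₀ : count pattern₀ 0 n ≡ k
  count-pattern₀ = begin
    count pattern₀ 0 n                            ≡⟨ cong (count pattern₀ 0) (sym d+e≡n) ⟩
    count pattern₀ 0 (d + e)                      ≡⟨ count-+ pattern₀ 0 d e ⟩
    count pattern₀ 0 d + count pattern₀ d e       ≡⟨ cong₂ _+_ (count-cong pattern₀ (multiple a) 0 0 d (λ t lt → pattern₀-< t lt))
                                                             (count-cong pattern₀ (multiple b) d 0 e (λ t _ → pattern₀-+ t)) ⟩
    count (multiple a) 0 d + count (multiple b) 0 e ≡⟨ cong₂ _+_ (count-multiple a d a*s≤d) (count-multiple b e b*s≤e) ⟩
    a + b                                         ≡⟨ a+b≡k ⟩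
    k                                             ∎
    where
    open ≡-Reasoning
    e : ℕ
    e = n ∸ d
    d+e≡n : d + e ≡ n
    d+e≡n = m+[n∸m]≡n d≤n
    b*s≤e : b * s ≤ e
    b*s≤e = +-cancelˡ-≤ d (b * s) e (subst (d + b * s ≤_) (sym d+e≡n) d+b*s≤n)

  pattern₀-spaced : CyclicallySpaced n s pattern₀
  pattern₀-spaced p q p<q _ hp hq = go (pattern₀-point p hp) (pattern₀-point q hq)
    where
    step : ∀ {t t'} → t < t' → t * s + s ≤ t' * s
    step {t} {t'} lt = subst (_≤ t' * s) (+-comm s (t * s)) (*-monoˡ-≤ s lt)
    go : Point p → Point q → (p + s ≤ q) × (q + s ≤ p + n)
    go (first t _ refl) (first t' t'<a refl) =
      step (*-cancelʳ-< s t t' p<q) ,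
      ≤-trans (step t'<a) (≤-trans a*s≤d (≤-trans d≤n (m≤n+m n (t * s))))
    go (first t t<a refl) (second t' t'<b refl) =
      ≤-trans (step t<a) (≤-trans a*s≤d (m≤m+n d (t' * s))) ,
      ≤-trans (subst (_≤ d + b * s) (sym (+-assoc d (t' * s) s)) (+-monoʳ-≤ d (step t'<b)))
              (≤-trans d+b*s≤n (m≤n+m n (t * s)))
    go (second t _ refl) (first t' t'<a refl) =
      ⊥-elim (<⇒≱ p<q (≤-trans (<⇒≤ (<-≤-trans (m<m+n (t' * s) (s≤s z≤n)) (step t'<a)))
                                (≤-trans a*s≤d (m≤m+n d (t * s)))))
    go (second t _ refl) (second t' t'<b refl) =
      subst (_≤ d + t' * s) (sym (+-assoc d (t * s) s)) (+-monoʳ-≤ d (step (*-cancelʳ-< s t t' (+-cancelˡ-< d _ _ p<q)))) ,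
      ≤-trans (subst (_≤ d + b * s) (sym (+-assoc d (t' * s) s)) (+-monoʳ-≤ d (step t'<b)))
              (≤-trans d+b*s≤n (m≤n+m n (d + t * s)))

  private
    c : ℕ
    c = n ∸ I
    I+c≡n : I + c ≡ n
    I+c≡n = m+[n∸m]≡n (≤-trans (m≤m+n I d) (<⇒≤ I+d<n))

  marks : ℕ → Bool
  marks = pattern₀ ∘ shift c

  count-marks : count marks 0 n ≡ k
  count-marks = trans (count-shift pattern₀ c (m∸n≤m n I)) count-pattern₀

  marks-I : marks I ≡ true
  marks-I = trans (cong pattern₀ (shift-wrap c I 0 (trans (+-identityʳ n) (sym I+c≡n))))
                  (trans (pattern₀-< 0 d≥1) (multiple-0 a a≥1))

  marks-I+d : marks (I + d) ≡ true
  marks-I+d = trans (cong pattern₀ (shift-wrap c (I + d) d (trans (cong (_+ d) (sym I+c≡n)) (lem I c d))))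
                (trans (cong pattern₀ (sym (+-identityʳ d))) (trans (pattern₀-+ 0) (multiple-0 b b≥1)))
    where
    lem : ∀ I c d → I + c + d ≡ I + d + c
    lem = solve-∀

  marks-stable : ∀ x y → x < n → y < n → x ≢ y → marks x ≡ true → marks y ≡ true → StableDistance n s ∣ x - y ∣
  marks-stable x y xn yn x≢y hx hy = transfer (shift-distance c x y xn yn)
    where
    X : ℕ
    X = shift c x
    Y : ℕ
    Y = shift c y
    ∣x-y∣<n : ∣ x - y ∣ < n
    ∣x-y∣<n with ∣m-n∣≡[m∸n]∨[n∸m] x y
    ... | inj₁ e = subst (_< n) (sym e) (≤-<-trans (m∸n≤m x y) xn)
    ... | inj₂ e = subst (_< n) (sym e) (≤-<-trans (m∸n≤m y x) yn)
    X≢Y : X ≢ Y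
    X≢Y X≡Y with shift-distance c x y xn yn
    ... | inj₁ e = x≢y (∣m-n∣≡0⇒m≡n (trans (sym e) (trans (cong (∣_- Y ∣) X≡Y) (∣n-n∣≡0 Y))))
    ... | inj₂ e = <-irrefl (trans (sym (+-identityˡ _)) (trans (cong (_+ ∣ x - y ∣)
            (sym (trans (cong (∣_- Y ∣) X≡Y) (∣n-n∣≡0 Y)))) e)) ∣x-y∣<n
    stable-XY : StableDistance n s ∣ X - Y ∣
    stable-XY with <-cmp X Y
    ... | tri< lt _ _ = let r = pattern₀-spaced X Y lt (shift<n c y yn (m∸n≤m n I)) hx hy
                        in spaced⇒StableDistance X Y lt (proj₁ r) (proj₂ r)
    ... | tri≈ _ eq _ = ⊥-elim (X≢Y eq)
    ... | tri> _ _ gt = let r = pattern₀-spaced Y X gt (shift<n c x xn (m∸n≤m n I)) hy hx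
                        in subst (StableDistance n s) (∣-∣-comm Y X) (spaced⇒StableDistance Y X gt (proj₁ r) (proj₂ r))
    transfer : SameCycDist n ∣ X - Y ∣ ∣ x - y ∣ → StableDistance n s ∣ x - y ∣
    transfer (inj₁ e) = subst (StableDistance n s) e stable-XY
    transfer (inj₂ e) = StableDistance-complement e stable-XY

-- Adjacency in G(n,k,s)

module Adjacency (n s' k : ℕ) (s≤n : suc s' ≤ n) where

  s : ℕ
  s = suc s'

  A : Fin n → Fin n → Set
  A = Adj n k s

  Admissibleₙ : ℕ → Set
  Admissibleₙ = Admissible n s k

  CommonStableSet : Fin n → Fin n → Set
  CommonStableSet i j = Σ (Subset n) λ S → InStableFamily n k s S × i ∈ S × j ∈ S

  private
    distance-< : ∀ (i j : Fin n) → toℕ i < toℕ j → ∃ λ d → toℕ i + d ≡ toℕ j × dist i j ≡ d × 1 ≤ d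
    distance-< i j i<j with m≤n⇒∃[o]m+o≡n (<⇒≤ i<j)
    ... | d , i+d≡j = d , i+d≡j , trans (cong (∣ toℕ i -_∣) (sym i+d≡j)) (∣m-m+n∣≡n (toℕ i) d) ,
                       +-cancelˡ-≤ (toℕ i) 1 d (subst₂ _≤_ (+-comm 1 (toℕ i)) (sym i+d≡j) i<j)

  stable⇒spaced : ∀ (S : Subset n) → Stable n s S → CyclicallySpaced n s (indicator S)
  stable⇒spaced S stable p q p<q q<n χp χq with m≤n⇒∃[o]m+o≡n (<⇒≤ p<q)
  ... | r , refl = +-monoʳ-≤ p s≤r , subst (_≤ p + n) (sym (+-assoc p r s)) (+-monoʳ-≤ p (m≤o∸n⇒m+n≤o r s≤n r≤n∸s))
    where
    p<n : p < n
    p<n = <-trans p<q q<n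
    x : Fin n
    x = fromℕ< p<n
    y : Fin n
    y = fromℕ< q<n
    x≡p : toℕ x ≡ p
    x≡p = FP.toℕ-fromℕ< p<n
    y≡p+r : toℕ y ≡ p + r
    y≡p+r = FP.toℕ-fromℕ< q<n
    stable-xy : (s ≤ ∣ toℕ x - toℕ y ∣) × (∣ toℕ x - toℕ y ∣ ≤ n ∸ s)
    stable-xy = stable x y (indicator⇒∈ S x (subst (λ z → indicator S z ≡ true) (sym x≡p) χp))
                           (indicator⇒∈ S y (subst (λ z → indicator S z ≡ true) (sym y≡p+r) χq))
                           (λ e → <-irrefl (trans (sym x≡p) (trans (cong toℕ e) y≡p+r)) p<q)
    dist≡r : ∣ toℕ x - toℕ y ∣ ≡ r
    dist≡r = trans (cong₂ ∣_-_∣ x≡p y≡p+r) (∣m-m+n∣≡n p r)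
    s≤r : s ≤ r
    s≤r = subst (s ≤_) dist≡r (proj₁ stable-xy)
    r≤n∸s : r ≤ n ∸ s
    r≤n∸s = subst (_≤ n ∸ s) dist≡r (proj₂ stable-xy)

  common⇒admissible< : ∀ i j → toℕ i < toℕ j → CommonStableSet i j → Admissibleₙ (dist i j)
  common⇒admissible< i j i<j (S , (∣S∣≡k , stable) , i∈S , j∈S)
    with distance-< i j i<j | m≤n⇒∃[o]m+o≡n (FP.toℕ<n j)
  ... | d , i+d≡j , dist≡d , d≥1 | e , j+e≡n =
    subst Admissibleₙ (sym dist≡d) (Necessity.admissible (stable⇒spaced S stable)
      (trans (cong (_+ suc e) i+d≡j) (trans (+-suc (toℕ j) e) j+e≡n)) d≥1 (s≤s z≤n)
      (∈⇒indicator S i i∈S) (subst (λ z → indicator S z ≡ true) (sym i+d≡j) (∈⇒indicator S j j∈S))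
      (trans (sym (∣∣≡count-indicator S)) ∣S∣≡k))

  admissible⇒common< : ∀ i j → toℕ i < toℕ j → Admissibleₙ (dist i j) → CommonStableSet i j
  admissible⇒common< i j i<j adm with distance-< i j i<j
  ... | d , i+d≡j , dist≡d , d≥1 = S , (∣S∣≡k , stable) , i∈S , j∈S
    where
    open Construction {I = toℕ i} (subst (_< n) (sym i+d≡j) (FP.toℕ<n j)) d≥1 (subst Admissibleₙ dist≡d adm)
    S : Subset n
    S = tabulate (marks ∘ toℕ)
    ∣S∣≡k : ∣ S ∣ ≡ k
    ∣S∣≡k = trans (∣tabulate∣≡count n marks) count-marks
    stable : Stable n s S
    stable x y x∈S y∈S x≢y = marks-stable (toℕ x) (toℕ y) (FP.toℕ<n x) (FP.toℕ<n y) (x≢y ∘ FP.toℕ-injective)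
                               (Equivalence.to (∈tabulate⇔ n marks x) x∈S) (Equivalence.to (∈tabulate⇔ n marks y) y∈S)
    i∈S : i ∈ S
    i∈S = Equivalence.from (∈tabulate⇔ n marks i) marks-I
    j∈S : j ∈ S
    j∈S = Equivalence.from (∈tabulate⇔ n marks j) (subst (λ z → marks z ≡ true) i+d≡j marks-I+d)

  common-swap : ∀ {i j} → CommonStableSet i j → CommonStableSet j i
  common-swap (S , f , i∈S , j∈S) = S , f , j∈S , i∈S

  common⇔admissible : ∀ i j → i ≢ j → CommonStableSet i j ⇔ Admissibleₙ (dist i j)
  common⇔admissible i j i≢j with <-cmp (toℕ i) (toℕ j)
  ... | tri< lt _ _ = mk⇔ (common⇒admissible< i j lt) (admissible⇒common< i j lt)
  ... | tri≈ _ eq _ = ⊥-elim (i≢j (FP.toℕ-injective eq))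
  ... | tri> _ _ gt = mk⇔
    (λ c → subst Admissibleₙ (∣-∣-comm (toℕ j) (toℕ i)) (common⇒admissible< j i gt (common-swap c)))
    (λ adm → common-swap (admissible⇒common< j i gt (subst Admissibleₙ (∣-∣-comm (toℕ i) (toℕ j)) adm)))

  Adj⇒¬admissible : ∀ {i j} → A i j → (i ≢ j) × ¬ Admissibleₙ (dist i j)
  Adj⇒¬admissible {i} {j} (i≢j , ¬common) = i≢j , ¬common ∘ Equivalence.from (common⇔admissible i j i≢j)

  ¬admissible⇒Adj : ∀ {i j} → i ≢ j → ¬ Admissibleₙ (dist i j) → A i j
  ¬admissible⇒Adj {i} {j} i≢j ¬adm = i≢j , ¬adm ∘ Equivalence.to (common⇔admissible i j i≢j)

  admissible-complement : ∀ {d d'} → d + d' ≡ n → Admissibleₙ d → Admissibleₙ d'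
  admissible-complement {d} {d'} d+d'≡n (mkAdmissible a b a≥1 b≥1 a+b≡k a*s≤d d+b*s≤n) =
    mkAdmissible b a b≥1 a≥1 (trans (+-comm b a) a+b≡k)
      (+-cancelˡ-≤ d (b * s) d' (subst (d + b * s ≤_) (sym d+d'≡n) d+b*s≤n))
      (subst (d' + a * s ≤_) (trans (+-comm d' d) d+d'≡n) (+-monoʳ-≤ d' a*s≤d))

  admissible-resp : ∀ {d d'} → SameCycDist n d' d → Admissibleₙ d → Admissibleₙ d'
  admissible-resp (inj₁ e) adm = subst Admissibleₙ (sym e) adm
  admissible-resp {d} {d'} (inj₂ e) adm = admissible-complement (trans (+-comm d d') e) adm

  admissible-resp⁻ : ∀ {d d'} → SameCycDist n d' d → Admissibleₙ d' → Admissibleₙ d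
  admissible-resp⁻ (inj₁ e) adm = subst Admissibleₙ e adm
  admissible-resp⁻ (inj₂ e) adm = admissible-complement e adm

  admissible⇒s≤ : ∀ {d} → Admissibleₙ d → s ≤ d
  admissible⇒s≤ (mkAdmissible (suc a) b _ _ _ a*s≤d _) = ≤-trans (m≤m+n s (a * s)) a*s≤d

  admissible⇒+s≤n : ∀ {d} → Admissibleₙ d → d + s ≤ n
  admissible⇒+s≤n {d} (mkAdmissible a (suc b) _ _ _ _ d+b*s≤n) = ≤-trans (+-monoʳ-≤ d (m≤m+n s (b * s))) d+b*s≤n

  PreservesCycDist⇒Adj⇔ : ∀ {f} → PreservesCycDist f → ∀ i j → A i j ⇔ A (f i) (f j)
  PreservesCycDist⇒Adj⇔ {f} pres i j = mk⇔
    (λ a → let (i≢j , ¬adm) = Adj⇒¬admissible a in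
      ¬admissible⇒Adj (i≢j ∘ PreservesCycDist⇒injective pres) (¬adm ∘ admissible-resp⁻ (pres i j)))
    (λ a → let (fi≢fj , ¬adm) = Adj⇒¬admissible a in
      ¬admissible⇒Adj (fi≢fj ∘ cong f) (¬adm ∘ admissible-resp (pres i j)))

-- The dihedral group

[m%n+o]%n≡[m+o]%n : ∀ m o n .{{_ : NonZero n}} → (m % n + o) % n ≡ (m + o) % n
[m%n+o]%n≡[m+o]%n m o n = begin
  (m % n + o) % n           ≡⟨ %-distribˡ-+ (m % n) o n ⟩
  (m % n % n + o % n) % n   ≡⟨ cong (λ z → (z + o % n) % n) (m%n%n≡m%n m n) ⟩
  (m % n + o % n) % n       ≡⟨ sym (%-distribˡ-+ m o n) ⟩
  (m + o) % n               ∎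
  where open ≡-Reasoning

module Cycle (m' : ℕ) where

  n : ℕ
  n = suc (suc m')
  open Shift n

  toℕ-rot : ∀ x → toℕ (rot {n} x) ≡ (toℕ x + 1) % n
  toℕ-rot x = trans (FP.toℕ-fromℕ< (m%n<n (suc (toℕ x)) n)) (cong (_% n) (+-comm 1 (toℕ x)))

  translate : ∀ c → c ≤ n → Fin n → Fin n
  translate c c≤n x = fromℕ< (shift<n c (toℕ x) (FP.toℕ<n x) c≤n)

  toℕ-translate≡shift : ∀ c c≤n x → toℕ (translate c c≤n x) ≡ shift c (toℕ x)
  toℕ-translate≡shift c c≤n x = FP.toℕ-fromℕ< (shift<n c (toℕ x) (FP.toℕ<n x) c≤n)

  toℕ-translate : ∀ c c≤n x → toℕ (translate c c≤n x) ≡ (toℕ x + c) % n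
  toℕ-translate c c≤n x = trans (toℕ-translate≡shift c c≤n x) (shift≡mod c (toℕ x) (FP.toℕ<n x) c≤n)

  translate-preserves : ∀ c c≤n → PreservesCycDist (translate c c≤n)
  translate-preserves c c≤n x y =
    subst₂ (λ a b → SameCycDist n ∣ a - b ∣ (dist x y))
      (sym (toℕ-translate≡shift c c≤n x)) (sym (toℕ-translate≡shift c c≤n y))
      (shift-distance c (toℕ x) (toℕ y) (FP.toℕ<n x) (FP.toℕ<n y))

  translate-inverse : ∀ c c' (c≤n : c ≤ n) (c'≤n : c' ≤ n) → c + c' ≡ n → ∀ x → translate c c≤n (translate c' c'≤n x) ≡ x
  translate-inverse c c' c≤n c'≤n c+c'≡n x = FP.toℕ-injective (begin
    toℕ (translate c c≤n (translate c' c'≤n x)) ≡⟨ toℕ-translate c c≤n (translate c' c'≤n x) ⟩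
    (toℕ (translate c' c'≤n x) + c) % n         ≡⟨ cong (λ z → (z + c) % n) (toℕ-translate c' c'≤n x) ⟩
    ((toℕ x + c') % n + c) % n                  ≡⟨ [m%n+o]%n≡[m+o]%n (toℕ x + c') c n ⟩
    (toℕ x + c' + c) % n                        ≡⟨ cong (_% n) (trans (+-assoc (toℕ x) c' c)
                                                                    (cong (toℕ x +_) (trans (+-comm c' c) c+c'≡n))) ⟩
    (toℕ x + n) % n                             ≡⟨ [m+n]%n≡m%n (toℕ x) n ⟩
    toℕ x % n                                   ≡⟨ m<n⇒m%n≡m (FP.toℕ<n x) ⟩
    toℕ x                                       ∎)
    where open ≡-Reasoning

  rot-translate : ∀ c (c≤n : c ≤ n) x → rot {n} (translate c c≤n x) ≡ translate c c≤n (rot x)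
  rot-translate c c≤n x = FP.toℕ-injective (begin
    toℕ (rot (translate c c≤n x))  ≡⟨ toℕ-rot (translate c c≤n x) ⟩
    (toℕ (translate c c≤n x) + 1) % n ≡⟨ cong (λ z → (z + 1) % n) (toℕ-translate c c≤n x) ⟩
    ((toℕ x + c) % n + 1) % n      ≡⟨ [m%n+o]%n≡[m+o]%n (toℕ x + c) 1 n ⟩
    (toℕ x + c + 1) % n            ≡⟨ cong (_% n) (lem (toℕ x) c) ⟩
    (toℕ x + 1 + c) % n            ≡⟨ sym ([m%n+o]%n≡[m+o]%n (toℕ x + 1) c n) ⟩
    ((toℕ x + 1) % n + c) % n      ≡⟨ cong (λ z → (z + c) % n) (sym (toℕ-rot x)) ⟩
    (toℕ (rot x) + c) % n          ≡⟨ sym (toℕ-translate c c≤n (rot x)) ⟩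
    toℕ (translate c c≤n (rot x))  ∎)
    where
    open ≡-Reasoning
    lem : ∀ x c → x + c + 1 ≡ x + 1 + c
    lem = solve-∀

  rot≗translate-1 : ∀ x → rot {n} x ≡ translate 1 (s≤s z≤n) x
  rot≗translate-1 x = FP.toℕ-injective (trans (toℕ-rot x) (sym (toℕ-translate 1 (s≤s z≤n) x)))

  rot-preserves : PreservesCycDist (rot {n})
  rot-preserves x y = subst₂ (λ a b → SameCycDist n (dist a b) (dist x y))
    (sym (rot≗translate-1 x)) (sym (rot≗translate-1 y)) (translate-preserves 1 (s≤s z≤n) x y)

  rot-injective : ∀ {x y} → rot {n} x ≡ rot y → x ≡ y
  rot-injective = PreservesCycDist⇒injective rot-preserves

  -- refl′ on representatives in [0, n), avoiding the junk value n
  mirror : ℕ → ℕ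
  mirror zero = 0
  mirror (suc x) = n ∸ suc x

  toℕ-refl′≡mod : ∀ x → toℕ (refl′ {n} x) ≡ (n ∸ toℕ x) % n
  toℕ-refl′≡mod x = FP.toℕ-fromℕ< (m%n<n (n ∸ toℕ x) n)

  toℕ-refl′ : ∀ x → toℕ (refl′ {n} x) ≡ mirror (toℕ x)
  toℕ-refl′ x = trans (toℕ-refl′≡mod x) (mod≡mirror (toℕ x) (FP.toℕ<n x))
    where
    mod≡mirror : ∀ X → X < n → (n ∸ X) % n ≡ mirror X
    mod≡mirror zero _ = n%n≡0 n
    mod≡mirror (suc X) X<n = m<n⇒m%n≡m (∸-monoʳ-< (s≤s z≤n) (<⇒≤ X<n))

  mirror-distance : ∀ X Y → X < n → Y < n → SameCycDist n ∣ mirror X - mirror Y ∣ ∣ X - Y ∣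
  mirror-distance zero zero _ _ = inj₁ refl
  mirror-distance zero (suc Y) _ lt = inj₂ (m∸n+n≡m (<⇒≤ lt))
  mirror-distance (suc X) zero lt _ = inj₂ (trans (cong (_+ suc X) (∣-∣-identityʳ (n ∸ suc X))) (m∸n+n≡m (<⇒≤ lt)))
  mirror-distance (suc X) (suc Y) lx ly = inj₁ (begin
      ∣ a - b ∣                       ≡⟨ sym (∣m+n-m+o∣≡∣n-o∣ (X1 + Y1) a b) ⟩
      ∣ X1 + Y1 + a - X1 + Y1 + b ∣   ≡⟨ cong₂ ∣_-_∣ (trans (l₁ X1 Y1 a) (cong (_+ Y1) (m+[n∸m]≡n (<⇒≤ lx))))
                                                    (trans (l₂ X1 Y1 b) (cong (_+ X1) (m+[n∸m]≡n (<⇒≤ ly)))) ⟩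
      ∣ n + Y1 - n + X1 ∣             ≡⟨ ∣m+n-m+o∣≡∣n-o∣ n Y1 X1 ⟩
      ∣ Y1 - X1 ∣                     ≡⟨ ∣-∣-comm Y1 X1 ⟩
      ∣ X1 - Y1 ∣                     ∎)
    where
    open ≡-Reasoning
    X1 : ℕ
    X1 = suc X
    Y1 : ℕ
    Y1 = suc Y
    a : ℕ
    a = n ∸ X1
    b : ℕ
    b = n ∸ Y1
    l₁ : ∀ x y a → x + y + a ≡ x + a + y
    l₁ = solve-∀
    l₂ : ∀ x y b → x + y + b ≡ y + b + x
    l₂ = solve-∀

  refl′-preserves : PreservesCycDist (refl′ {n})
  refl′-preserves x y = subst₂ (λ a b → SameCycDist n ∣ a - b ∣ (dist x y)) (sym (toℕ-refl′ x)) (sym (toℕ-refl′ y))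
    (mirror-distance (toℕ x) (toℕ y) (FP.toℕ<n x) (FP.toℕ<n y))

  Dihedral⇒preserves : ∀ {f} → Dihedral n f → PreservesCycDist f
  Dihedral⇒preserves d-id x y = inj₁ refl
  Dihedral⇒preserves (d-rot {f} d) x y = SameCycDist-trans (rot-preserves (f x) (f y)) (Dihedral⇒preserves d x y)
  Dihedral⇒preserves (d-ref {f} d) x y = SameCycDist-trans (refl′-preserves (f x) (f y)) (Dihedral⇒preserves d x y)
  Dihedral⇒preserves (d-ext {f} {g} d f≗g) x y =
    subst₂ (λ a b → SameCycDist n (dist a b) (dist x y)) (f≗g x) (f≗g y) (Dihedral⇒preserves d x y)

  rotations : ℕ → (Fin n → Fin n) → Fin n → Fin n
  rotations zero f = f
  rotations (suc c) f = rot ∘ rotations c f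

  toℕ-rotations : ∀ f c x → toℕ (rotations c f x) ≡ (toℕ (f x) + c) % n
  toℕ-rotations f zero x = sym (trans (cong (_% n) (+-identityʳ (toℕ (f x)))) (m<n⇒m%n≡m (FP.toℕ<n (f x))))
  toℕ-rotations f (suc c) x = begin
      toℕ (rot (rotations c f x))   ≡⟨ toℕ-rot (rotations c f x) ⟩
      (toℕ (rotations c f x) + 1) % n ≡⟨ cong (λ z → (z + 1) % n) (toℕ-rotations f c x) ⟩
      ((toℕ (f x) + c) % n + 1) % n ≡⟨ [m%n+o]%n≡[m+o]%n (toℕ (f x) + c) 1 n ⟩
      (toℕ (f x) + c + 1) % n       ≡⟨ cong (_% n) (trans (+-assoc (toℕ (f x)) c 1) (cong (toℕ (f x) +_) (+-comm c 1))) ⟩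
      (toℕ (f x) + suc c) % n       ∎
    where open ≡-Reasoning

  translate∘dihedral : ∀ c (c≤n : c ≤ n) {f} → Dihedral n f → Dihedral n (translate c c≤n ∘ f)
  translate∘dihedral c c≤n {f} d = d-ext (rotations-dihedral c) (λ x → FP.toℕ-injective
      (trans (toℕ-rotations f c x) (sym (toℕ-translate c c≤n (f x)))))
    where
    rotations-dihedral : ∀ c → Dihedral n (rotations c f)
    rotations-dihedral zero = d
    rotations-dihedral (suc c) = d-rot (rotations-dihedral c)

  CycleEdge : Fin n → Fin n → Set
  CycleEdge u v = (v ≡ rot u) ⊎ (u ≡ rot v)

  CycleEdge-sym : ∀ {u v} → CycleEdge u v → CycleEdge v u
  CycleEdge-sym (inj₁ e) = inj₂ e
  CycleEdge-sym (inj₂ e) = inj₁ e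

  toℕ-rot≡shift : ∀ x → toℕ (rot {n} x) ≡ shift 1 (toℕ x)
  toℕ-rot≡shift x = trans (toℕ-rot x) (sym (shift≡mod 1 (toℕ x) (FP.toℕ<n x) (s≤s z≤n)))

  private
    unit⇒CycleEdge< : ∀ u v → toℕ u < toℕ v → SameCycDist n (dist u v) 1 → CycleEdge u v
    unit⇒CycleEdge< u v u<v unit with m≤n⇒∃[o]m+o≡n (<⇒≤ u<v)
    ... | r , u+r≡v = go (subst (λ d → SameCycDist n d 1) (trans (cong (∣ U -_∣) (sym u+r≡v)) (∣m-m+n∣≡n U r)) unit)
      where
      U : ℕ
      U = toℕ u
      V : ℕ
      V = toℕ v
      go : SameCycDist n r 1 → CycleEdge u v
      go (inj₁ refl) = inj₁ (FP.toℕ-injective (trans (sym u+r≡v)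
                         (trans (sym (shift-< 1 U (subst (_< n) (sym u+r≡v) (FP.toℕ<n v)))) (sym (toℕ-rot≡shift u)))))
      go (inj₂ r+1≡n) = inj₂ (FP.toℕ-injective (trans U≡0 (sym (trans (toℕ-rot≡shift v)
                          (shift-wrap 1 V 0 (trans (+-identityʳ n) (sym V+1≡n)))))))
        where
        U≡0 : U ≡ 0
        U≡0 = n≤0⇒n≡0 (+-cancelʳ-≤ (r + 1) U 0 (subst (U + (r + 1) ≤_) (sym r+1≡n)
               (subst (_≤ n) (trans (+-comm 1 (U + r)) (+-assoc U r 1))
                 (subst (λ z → suc z ≤ n) (sym u+r≡v) (FP.toℕ<n v)))))
        V+1≡n : V + 1 ≡ n
        V+1≡n = trans (cong (_+ 1) (trans (sym u+r≡v) (cong (_+ r) U≡0))) r+1≡n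

  unit⇒CycleEdge : ∀ u v → SameCycDist n (dist u v) 1 → CycleEdge u v
  unit⇒CycleEdge u v unit with <-cmp (toℕ u) (toℕ v)
  ... | tri< lt _ _ = unit⇒CycleEdge< u v lt unit
  ... | tri> _ _ gt = CycleEdge-sym (unit⇒CycleEdge< v u gt (subst (λ d → SameCycDist n d 1) (∣-∣-comm (toℕ u) (toℕ v)) unit))
  ... | tri≈ _ eq _ = ⊥-elim (not-unit (subst (λ d → SameCycDist n d 1) (trans (cong (∣_- toℕ v ∣) eq) (∣n-n∣≡0 (toℕ v))) unit))
    where
    not-unit : ¬ SameCycDist n 0 1
    not-unit (inj₂ ())

  point : ∀ c → c < n → Fin n
  point c c<n = fromℕ< c<n

  rot-point : ∀ c (c+1<n : suc c < n) → rot {n} (point c (<-trans (n<1+n c) c+1<n)) ≡ point (suc c) c+1<n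
  rot-point c c+1<n = FP.toℕ-injective (trans (toℕ-rot (point c (<-trans (n<1+n c) c+1<n))) (trans
    (cong (λ z → (z + 1) % n) (FP.toℕ-fromℕ< (<-trans (n<1+n c) c+1<n)))
    (trans (m<n⇒m%n≡m (subst (_< n) (+-comm 1 c) c+1<n)) (trans (+-comm c 1) (sym (FP.toℕ-fromℕ< c+1<n))))))

  rot-refl′-point : ∀ c (c+1<n : suc c < n) → rot {n} (refl′ (point (suc c) c+1<n)) ≡ refl′ (point c (<-trans (n<1+n c) c+1<n))
  rot-refl′-point c c+1<n = FP.toℕ-injective (begin
    toℕ (rot (refl′ y))        ≡⟨ toℕ-rot (refl′ y) ⟩
    (toℕ (refl′ y) + 1) % n    ≡⟨ cong (λ z → (z + 1) % n) (toℕ-refl′≡mod y) ⟩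
    ((n ∸ toℕ y) % n + 1) % n  ≡⟨ [m%n+o]%n≡[m+o]%n (n ∸ toℕ y) 1 n ⟩
    (n ∸ toℕ y + 1) % n        ≡⟨ cong (λ z → (n ∸ z + 1) % n) (FP.toℕ-fromℕ< c+1<n) ⟩
    (n ∸ suc c + 1) % n        ≡⟨ cong (_% n) (trans (+-comm (n ∸ suc c) 1) (sym (+-∸-assoc 1 (<⇒≤ c+1<n)))) ⟩
    (n ∸ c) % n                ≡⟨ cong (λ z → (n ∸ z) % n) (sym (FP.toℕ-fromℕ< c<n)) ⟩
    (n ∸ toℕ y′) % n           ≡⟨ sym (toℕ-refl′≡mod y′) ⟩
    toℕ (refl′ y′)             ∎)
    where
    open ≡-Reasoning
    c<n : c < n
    c<n = <-trans (n<1+n c) c+1<n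
    y : Fin n
    y = point (suc c) c+1<n
    y′ : Fin n
    y′ = point c c<n

  refl′-0 : refl′ {n} F.zero ≡ F.zero
  refl′-0 = FP.toℕ-injective (toℕ-refl′ F.zero)

  -- R orients every cycle edge and g walks the cycle along R.
  walk-unique : (σ g : Fin n → Fin n) (R : Fin n → Fin n → Set) →
        (∀ u v → CycleEdge u v → CycleEdge (σ u) (σ v)) → (∀ {x y} → σ x ≡ σ y → x ≡ y) →
        (∀ x y → CycleEdge x y → R x y ⊎ R y x) →
        (∀ {x y y'} → R x y → R x y' → y ≡ y') → (∀ {x x' y} → R x y → R x' y → x ≡ x') →
        (∀ c (c+1<n : suc c < n) → R (g (point c (<-trans (n<1+n c) c+1<n))) (g (point (suc c) c+1<n))) →
        σ F.zero ≡ g F.zero → σ (F.suc F.zero) ≡ g (F.suc F.zero) → ∀ x → σ x ≡ g x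
  walk-unique σ g R σ-edge σ-inj orient R-functional R-injective g-walks σ0 σ1 x =
    subst (λ y → σ y ≡ g y) (FP.fromℕ<-toℕ x (FP.toℕ<n x)) (agree (toℕ x) (FP.toℕ<n x))
    where
    Agree₂ : ℕ → Set
    Agree₂ c = ∀ (c+1<n : suc c < n) → (σ (point c (<-trans (n<1+n c) c+1<n)) ≡ g (point c (<-trans (n<1+n c) c+1<n))) ×
                                        (σ (point (suc c) c+1<n) ≡ g (point (suc c) c+1<n))
    agree₂ : ∀ c → Agree₂ c
    agree₂ zero _ = σ0 , σ1
    agree₂ (suc c) c+2<n = previous , next
      where
      c+1<n : suc c < n
      c+1<n = <-trans (n<1+n (suc c)) c+2<n
      previous : σ (point (suc c) c+1<n) ≡ g (point (suc c) c+1<n)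
      previous = proj₂ (agree₂ c c+1<n)
      edge : CycleEdge (σ (point (suc c) c+1<n)) (σ (point (suc (suc c)) c+2<n))
      edge = σ-edge _ _ (inj₁ (sym (rot-point (suc c) c+2<n)))
      next : σ (point (suc (suc c)) c+2<n) ≡ g (point (suc (suc c)) c+2<n)
      next with orient _ _ edge
      ... | inj₁ r = R-functional (subst (λ z → R z _) previous r) (g-walks (suc c) c+2<n)
      ... | inj₂ r = ⊥-elim (c+2≢c (σ-inj (trans (R-injective (subst (R _) previous r) (g-walks c c+1<n))
                                                 (sym (proj₁ (agree₂ c c+1<n))))))
        where
        c+2≢c : point (suc (suc c)) c+2<n ≢ point c (<-trans (n<1+n c) c+1<n)
        c+2≢c e = <-irrefl (sym (trans (sym (FP.toℕ-fromℕ< c+2<n)) (trans (cong toℕ e) (FP.toℕ-fromℕ< (<-trans (n<1+n c) c+1<n)))))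
                  (<-trans (n<1+n c) (n<1+n (suc c)))
    agree : ∀ c (c<n : c < n) → σ (point c c<n) ≡ g (point c c<n)
    agree zero _ = σ0
    agree (suc c) c+1<n = proj₂ (agree₂ c c+1<n)

-- Automorphisms preserve the n-cycle

module Automorphisms (m' s₀ k : ℕ) (k≥2 : 2 ≤ k) (k*s+1≤n : k * suc (suc (suc s₀)) + 1 ≤ suc (suc m')) where

  n : ℕ
  n = suc (suc m')
  s : ℕ
  s = suc (suc (suc s₀))

  k*s≤n : k * s ≤ n
  k*s≤n = ≤-trans (m≤m+n (k * s) 1) k*s+1≤n

  s+s≤n : s + s ≤ n
  s+s≤n = subst (_≤ n) (cong (s +_) (+-identityʳ s)) (≤-trans (*-monoˡ-≤ s k≥2) k*s≤n)

  s≤n : s ≤ n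
  s≤n = ≤-trans (m≤m+n s s) s+s≤n

  open Adjacency n (suc (suc s₀)) k s≤n hiding (s)
  open Cycle m' hiding (n)

  ¬admissible-< : ∀ {d} → d < s → ¬ Admissibleₙ d
  ¬admissible-< d<s adm = <⇒≱ d<s (admissible⇒s≤ adm)

  ¬admissible-> : ∀ {d} → n < d + s → ¬ Admissibleₙ d
  ¬admissible-> n<d+s adm = <⇒≱ n<d+s (admissible⇒+s≤n adm)

  ¬admissible-1 : ¬ Admissibleₙ 1
  ¬admissible-1 = ¬admissible-< (s≤s (s≤s z≤n))

  private
    difference-pos : ∀ {i j b} → i + b ≡ j → i < j → 1 ≤ b
    difference-pos {i} {j} {b} i+b≡j i<j = +-cancelˡ-≤ i 1 b (subst₂ _≤_ (+-comm 1 i) (sym i+b≡j) i<j)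

  admissible-multiple : ∀ j → 1 ≤ j → j * s + s ≤ n → Admissibleₙ (j * s)
  admissible-multiple j j≥1 j*s+s≤n with j <? k
  ... | yes j<k with m≤n⇒∃[o]m+o≡n (<⇒≤ j<k)
  ...   | b , j+b≡k = mkAdmissible j b j≥1 (difference-pos j+b≡k j<k) j+b≡k ≤-refl
                        (subst (_≤ n) (trans (cong (_* s) (sym j+b≡k)) (*-distribʳ-+ s j b)) k*s≤n)
  admissible-multiple j j≥1 j*s+s≤n | no j≮k = mkAdmissible (k ∸ 1) 1 k-1≥1 ≤-refl (m∸n+n≡m (≤-trans (s≤s z≤n) k≥2))
      (*-monoˡ-≤ s (≤-trans (m∸n≤m k 1) (≮⇒≥ j≮k)))
      (subst (λ z → j * s + z ≤ n) (sym (+-identityʳ s)) j*s+s≤n)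
    where
    k-1≥1 : 1 ≤ k ∸ 1
    k-1≥1 = m+n≤o⇒m≤o∸n 1 k≥2

  admissible-multiple+1 : ∀ j → 1 ≤ j → j < k → Admissibleₙ (j * s + 1)
  admissible-multiple+1 j j≥1 j<k with m≤n⇒∃[o]m+o≡n (<⇒≤ j<k)
  ... | b , j+b≡k = mkAdmissible j b j≥1 (difference-pos j+b≡k j<k) j+b≡k (m≤m+n (j * s) 1)
                      (subst (_≤ n) (trans (cong (λ z → z * s + 1) (sym j+b≡k)) (lem j b s)) k*s+1≤n)
    where
    lem : ∀ j b s → (j + b) * s + 1 ≡ j * s + 1 + b * s
    lem = solve-∀

  admissible-s : Admissibleₙ s
  admissible-s = subst Admissibleₙ (*-identityˡ s)
    (admissible-multiple 1 ≤-refl (subst (_≤ n) (cong (_+ s) (sym (*-identityˡ s))) s+s≤n))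

  admissible-s+1 : Admissibleₙ (s + 1)
  admissible-s+1 = subst Admissibleₙ (cong (_+ 1) (*-identityˡ s)) (admissible-multiple+1 1 ≤-refl k≥2)

  OnlyNear : Fin n → Fin n → Fin n → Set
  OnlyNear u v w = (w ≡ u ⊎ A w u) × (w ≢ v) × ¬ A w v

  -- The graph property singling out the edges of the n-cycle among the edges of G(n,k,s).
  IndepDiff : Fin n → Fin n → Set
  IndepDiff u v = A u v × (∀ w w' → OnlyNear u v w → OnlyNear u v w' → ¬ A w w')

  PreservesAdj : (Fin n → Fin n) → Set
  PreservesAdj f = ∀ i j → A i j ⇔ A (f i) (f j)

  IndepDiff-transport : ∀ f g → (∀ x → g (f x) ≡ x) → (∀ w → f (g w) ≡ w) → PreservesAdj f →
                        ∀ u v → IndepDiff u v → IndepDiff (f u) (f v)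
  IndepDiff-transport f g gf fg pres u v (A-uv , indep) = Equivalence.to (pres u v) A-uv , λ w w' near near' A-ww' →
      indep (g w) (g w') (pull w near) (pull w' near')
        (Equivalence.from (pres (g w) (g w')) (subst₂ A (sym (fg w)) (sym (fg w')) A-ww'))
    where
    pull : ∀ w → OnlyNear (f u) (f v) w → OnlyNear u v (g w)
    pull w (w∈N[u] , w≢v , ¬A-wv) = pull-N w∈N[u] , (λ e → w≢v (trans (sym (fg w)) (cong f e))) ,
                                   (λ a → ¬A-wv (subst (λ z → A z (f v)) (fg w) (Equivalence.to (pres (g w) v) a)))
      where
      pull-N : w ≡ f u ⊎ A w (f u) → g w ≡ u ⊎ A (g w) u
      pull-N (inj₁ e) = inj₁ (trans (cong g e) (gf u))
      pull-N (inj₂ a) = inj₂ (Equivalence.from (pres (g w) u) (subst (λ z → A z (f u)) (sym (fg w)) a))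

  -- admissibility is not decided here, so non-adjacency only yields its double negation
  ¬A⇒¬¬admissible : ∀ {i j} → i ≢ j → ¬ A i j → ¬ ¬ Admissibleₙ (dist i j)
  ¬A⇒¬¬admissible i≢j ¬A ¬adm = ¬A (¬admissible⇒Adj i≢j ¬adm)

  private
    admissible-sym : ∀ {x y} → Admissibleₙ ∣ x - y ∣ → Admissibleₙ ∣ y - x ∣
    admissible-sym {x} {y} = subst Admissibleₙ (∣-∣-comm x y)

  Tail01 : Fin n → Set
  Tail01 w = ∃ λ b → (1 ≤ b) × (toℕ w + b * s ≡ suc n) × (1 ≤ toℕ w)

  OnlyNear-0-1 : ∀ w → OnlyNear F.zero (F.suc F.zero) w → ¬ ¬ Tail01 w
  OnlyNear-0-1 w (w∈N[0] , w≢1 , ¬A-w1) ¬tail = ¬A⇒¬¬admissible w≢1 ¬A-w1 (go w∈N[0])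
    where
    go : (w ≡ F.zero ⊎ A w F.zero) → ¬ Admissibleₙ (dist w (F.suc F.zero))
    go (inj₁ refl) adm = ¬admissible-1 adm
    go (inj₂ A-w0) adm with Adj⇒¬admissible A-w0
    ... | w≢0 , ¬adm-w with toℕ w in eqw
    ...   | zero = w≢0 (FP.toℕ-injective eqw)
    ...   | suc zero = w≢1 (FP.toℕ-injective eqw)
    ...   | suc (suc P₀) = ¬tail (b , b≥1 , tight , s≤s z≤n)
      where
      open Admissible adm
      tight : suc (suc P₀) + b * s ≡ suc n
      tight with m≤n⇒m<n∨m≡n d+b*s≤n
      ... | inj₂ eq = cong suc eq
      ... | inj₁ lt = ⊥-elim (¬adm-w (mkAdmissible a b a≥1 b≥1 a+b≡k (≤-trans a*s≤d (n≤1+n (suc P₀))) lt))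

  IndepDiff-0-1 : IndepDiff F.zero (F.suc F.zero)
  IndepDiff-0-1 = ¬admissible⇒Adj (λ ()) ¬admissible-1 , λ w w' near near' A-ww' →
      OnlyNear-0-1 w near (λ t → OnlyNear-0-1 w' near' (λ t' → separated t t' A-ww'))
    where
    apart : ∀ {W W' b b'} → 1 ≤ W' → 1 ≤ b → W + b * s ≡ suc n → W' + b' * s ≡ suc n → b < b' → Admissibleₙ ∣ W - W' ∣
    apart {W} {W'} {b} {b'} W'≥1 b≥1 e e' b<b' with m≤n⇒∃[o]m+o≡n (<⇒≤ b<b')
    ... | j , refl = subst Admissibleₙ (sym (trans (cong (∣_- W' ∣) W≡W'+js) (∣m+n-m∣≡n W' (j * s))))
                       (admissible-multiple j (difference-pos refl b<b') js+s≤n)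
      where
      lem : ∀ W' b j s → W' + (b + j) * s ≡ W' + j * s + b * s
      lem = solve-∀
      lem′ : ∀ W' j s b → W' + (j * s + b * s) ≡ W' + (b + j) * s
      lem′ = solve-∀
      W≡W'+js : W ≡ W' + j * s
      W≡W'+js = +-cancelʳ-≡ (b * s) W (W' + j * s) (trans e (trans (sym e') (lem W' b j s)))
      js+s≤n : j * s + s ≤ n
      js+s≤n = ≤-pred (≤-trans (+-mono-≤ W'≥1 (+-monoʳ-≤ (j * s) (≤-trans (m≤m+n s (0 * s)) (*-monoˡ-≤ s b≥1))))
                 (≤-reflexive (trans (lem′ W' j s b) e')))
    separated : ∀ {w w'} → Tail01 w → Tail01 w' → ¬ A w w'
    separated {w} {w'} (b , b≥1 , e , w≥1) (b' , b'≥1 , e' , w'≥1) a with Adj⇒¬admissible a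
    ... | w≢w' , ¬adm with <-cmp b b'
    ...   | tri≈ _ refl _ = w≢w' (FP.toℕ-injective (+-cancelʳ-≡ (b * s) _ _ (trans e (sym e'))))
    ...   | tri< b<b' _ _ = ¬adm (apart w'≥1 b≥1 e e' b<b')
    ...   | tri> _ _ b>b' = ¬adm (admissible-sym {toℕ w'} (apart w≥1 b'≥1 e' e b>b'))

  Head10 : Fin n → Set
  Head10 w = ∃ λ a → (toℕ w ≡ a * s) × (toℕ w + s ≤ n)

  OnlyNear-1-0 : ∀ w → OnlyNear (F.suc F.zero) F.zero w → ¬ ¬ Head10 w
  OnlyNear-1-0 w (w∈N[1] , w≢0 , ¬A-w0) ¬head = ¬A⇒¬¬admissible w≢0 ¬A-w0 (go w∈N[1])
    where
    go : (w ≡ F.suc F.zero ⊎ A w (F.suc F.zero)) → ¬ Admissibleₙ (dist w F.zero)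
    go (inj₁ refl) adm = ¬admissible-1 adm
    go (inj₂ A-w1) adm with Adj⇒¬admissible A-w1
    ... | w≢1 , ¬adm-w with toℕ w in eqw
    ...   | zero = w≢0 (FP.toℕ-injective eqw)
    ...   | suc zero = w≢1 (FP.toℕ-injective eqw)
    ...   | suc (suc P₀) = ¬head (a , tight , ≤-trans (+-monoʳ-≤ (suc (suc P₀)) s≤b*s) d+b*s≤n)
      where
      open Admissible adm
      s≤b*s : s ≤ b * s
      s≤b*s = ≤-trans (m≤m+n s (0 * s)) (*-monoˡ-≤ s b≥1)
      tight : suc (suc P₀) ≡ a * s
      tight with m≤n⇒m<n∨m≡n a*s≤d
      ... | inj₂ eq = sym eq
      ... | inj₁ lt = ⊥-elim (¬adm-w (mkAdmissible a b a≥1 b≥1 a+b≡k (≤-pred lt)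
                        (≤-trans (+-monoˡ-≤ (b * s) (n≤1+n (suc P₀))) d+b*s≤n)))

  IndepDiff-1-0 : IndepDiff (F.suc F.zero) F.zero
  IndepDiff-1-0 = ¬admissible⇒Adj (λ ()) ¬admissible-1 , λ w w' near near' A-ww' →
      OnlyNear-1-0 w near (λ h → OnlyNear-1-0 w' near' (λ h' → separated h h' A-ww'))
    where
    apart : ∀ {W W' a a'} → W ≡ a * s → W' ≡ a' * s → W' + s ≤ n → a < a' → Admissibleₙ ∣ W - W' ∣
    apart {W} {W'} {a} {a'} e e' W'+s≤n a<a' with m≤n⇒∃[o]m+o≡n (<⇒≤ a<a')
    ... | j , refl = subst Admissibleₙ (sym (trans (cong (∣ W -_∣) W'≡W+js) (∣m-m+n∣≡n W (j * s))))
                       (admissible-multiple j (difference-pos refl a<a')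
                         (≤-trans (+-monoˡ-≤ s (≤-trans (m≤n+m (j * s) W) (≤-reflexive (sym W'≡W+js)))) W'+s≤n))
      where
      W'≡W+js : W' ≡ W + j * s
      W'≡W+js = trans e' (trans (*-distribʳ-+ s a j) (cong (_+ j * s) (sym e)))
    separated : ∀ {w w'} → Head10 w → Head10 w' → ¬ A w w'
    separated {w} {w'} (a , e , w+s≤n) (a' , e' , w'+s≤n) A-ww' with Adj⇒¬admissible A-ww'
    ... | w≢w' , ¬adm with <-cmp a a'
    ...   | tri≈ _ refl _ = w≢w' (FP.toℕ-injective (trans e (sym e')))
    ...   | tri< a<a' _ _ = ¬adm (apart e e' w'+s≤n a<a')
    ...   | tri> _ _ a>a' = ¬adm (admissible-sym {toℕ w'} (apart e' e w+s≤n a>a'))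

  -- q and q + 1 lie in N[0] ∖ N[v] (V = toℕ v) and are adjacent, so that set is not independent
  record Obstruction (V : ℕ) : Set where
    field
      q : ℕ
      q+1<n : suc q < n
      ¬adm-q : ¬ Admissibleₙ q
      ¬adm-q+1 : ¬ Admissibleₙ (suc q)
      adm-q-V : Admissibleₙ ∣ q - V ∣
      adm-q+1-V : Admissibleₙ ∣ suc q - V ∣

  obstruction⇒¬IndepDiff : ∀ v → Obstruction (toℕ v) → ¬ IndepDiff F.zero v
  obstruction⇒¬IndepDiff v obs (_ , indep) = indep w w' (only-near q q<n ¬adm-q adm-q-V) (only-near (suc q) q+1<n ¬adm-q+1 adm-q+1-V) A-ww'
    where
    open Obstruction obs
    q<n : q < n
    q<n = <-trans (n<1+n q) q+1<n
    w : Fin n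
    w = point q q<n
    w' : Fin n
    w' = point (suc q) q+1<n
    only-near : ∀ p (p<n : p < n) → ¬ Admissibleₙ p → Admissibleₙ ∣ p - toℕ v ∣ → OnlyNear F.zero v (point p p<n)
    only-near p p<n ¬adm-p adm-p-V = near , p≢v , ¬A-pv
      where
      toℕ-p : toℕ (point p p<n) ≡ p
      toℕ-p = FP.toℕ-fromℕ< p<n
      adm-p-v : Admissibleₙ (dist (point p p<n) v)
      adm-p-v = subst (λ z → Admissibleₙ ∣ z - toℕ v ∣) (sym toℕ-p) adm-p-V
      near : point p p<n ≡ F.zero ⊎ A (point p p<n) F.zero
      near with p ≟ 0
      ... | yes p≡0 = inj₁ (FP.toℕ-injective (trans toℕ-p p≡0))
      ... | no p≢0 = inj₂ (¬admissible⇒Adj (λ e → p≢0 (trans (sym toℕ-p) (cong toℕ e)))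
                             (¬adm-p ∘ subst Admissibleₙ (trans (∣-∣-identityʳ (toℕ (point p p<n))) toℕ-p)))
      p≢v : point p p<n ≢ v
      p≢v refl = <⇒≱ (s≤s z≤n) (≤-trans (admissible⇒s≤ adm-p-v) (≤-reflexive (∣n-n∣≡0 (toℕ v))))
      ¬A-pv : ¬ A (point p p<n) v
      ¬A-pv A-pv = proj₂ (Adj⇒¬admissible A-pv) adm-p-v
    A-ww' : A w w'
    A-ww' = ¬admissible⇒Adj (λ e → <-irrefl (trans (sym (FP.toℕ-fromℕ< q<n)) (trans (cong toℕ e) (FP.toℕ-fromℕ< q+1<n))) (n<1+n q))
              (¬admissible-1 ∘ subst Admissibleₙ (trans (cong₂ ∣_-_∣ (FP.toℕ-fromℕ< q<n) (FP.toℕ-fromℕ< q+1<n))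
                                                        (trans (cong (∣ q -_∣) (+-comm 1 q)) (∣m-m+n∣≡n q 1))))

  private
    R : ℕ
    R = n ∸ suc s

    s+1+R≡n : suc s + R ≡ n
    s+1+R≡n = m+[n∸m]≡n (<-≤-trans (m<m+n s (s≤s z≤n)) s+s≤n)

    s+[1+R]≡n : s + suc R ≡ n
    s+[1+R]≡n = trans (+-suc s R) s+1+R≡n

    admissible-R : Admissibleₙ R
    admissible-R = admissible-complement (trans (cong (_+ R) (+-comm s 1)) s+1+R≡n) admissible-s+1

    admissible-1+R : Admissibleₙ (suc R)
    admissible-1+R = admissible-complement s+[1+R]≡n admissible-s

  -- V < s: take q = V + R, q + 1 = V + (n - s)
  obstruction-near : ∀ V → 2 ≤ V → V < s → Obstruction V
  obstruction-near V 2≤V V<s = record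
    { q = V + R
    ; q+1<n = subst (_< n) (+-suc V R) (subst (V + suc R <_) s+[1+R]≡n (+-monoˡ-< (suc R) V<s))
    ; ¬adm-q = ¬admissible-> n<q+s
    ; ¬adm-q+1 = ¬admissible-> (<-≤-trans n<q+s (n≤1+n (V + R + s)))
    ; adm-q-V = subst Admissibleₙ (sym (∣m+n-m∣≡n V R)) admissible-R
    ; adm-q+1-V = subst Admissibleₙ (sym (trans (cong (∣_- V ∣) (sym (+-suc V R))) (∣m+n-m∣≡n V (suc R)))) admissible-1+R
    }
    where
    n<q+s : n < V + R + s
    n<q+s = subst (_< V + R + s) (trans (+-comm (suc R) s) s+[1+R]≡n) (+-monoˡ-< s (+-monoˡ-< R 2≤V))

  private
    2+e₀≤s : ∀ {V e₀} → suc (suc V) + e₀ ≡ n → n < V + s → 2 + e₀ ≤ s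
    2+e₀≤s {V} {e₀} V+2+e₀≡n n<V+s =
      <⇒≤ (+-cancelˡ-< V (2 + e₀) s (subst (_< V + s) (sym (trans (lem V e₀) V+2+e₀≡n)) n<V+s))
      where
      lem : ∀ V e₀ → V + (2 + e₀) ≡ suc (suc V) + e₀
      lem = solve-∀

  -- n < V + s: with e = n - V (2 ≤ e < s), take q = s - e, so that V = q + (n - s)
  obstruction-far : ∀ V → V < n → V + 1 ≢ n → n < V + s → Obstruction V
  obstruction-far V V<n V+1≢n n<V+s with m≤n⇒∃[o]m+o≡n (≤∧≢⇒< V<n (λ e → V+1≢n (trans (+-comm V 1) e)))
  ... | e₀ , V+2+e₀≡n with m≤n⇒∃[o]m+o≡n (2+e₀≤s V+2+e₀≡n n<V+s)
  ...   | q , 2+e₀+q≡s = record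
    { q = q
    ; q+1<n = <-≤-trans q+1<s s≤n
    ; ¬adm-q = ¬admissible-< (<-trans (n<1+n q) q+1<s)
    ; ¬adm-q+1 = ¬admissible-< q+1<s
    ; adm-q-V = subst Admissibleₙ (sym (trans (cong (∣ q -_∣) V≡q+1+R) (∣m-m+n∣≡n q (suc R)))) admissible-1+R
    ; adm-q+1-V = subst Admissibleₙ (sym (trans (cong (∣ suc q -_∣) (trans V≡q+1+R (+-suc q R))) (∣m-m+n∣≡n (suc q) R)))
                    admissible-R
    }
    where
    lem₂ : ∀ V e₀ → suc (suc V) + e₀ ≡ (2 + e₀) + V
    lem₂ = solve-∀
    lem₃ : ∀ e₀ q R → 2 + e₀ + q + suc R ≡ (2 + e₀) + (q + suc R)
    lem₃ = solve-∀
    q+1<s : suc q < s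
    q+1<s = subst (suc q <_) 2+e₀+q≡s (s≤s (s≤s (m≤n+m q e₀)))
    V≡q+1+R : V ≡ q + suc R
    V≡q+1+R = +-cancelˡ-≡ (2 + e₀) V (q + suc R) (begin
      (2 + e₀) + V        ≡⟨ sym (lem₂ V e₀) ⟩
      suc (suc V) + e₀    ≡⟨ V+2+e₀≡n ⟩
      n                   ≡⟨ sym s+[1+R]≡n ⟩
      s + suc R           ≡⟨ cong (_+ suc R) (sym 2+e₀+q≡s) ⟩
      2 + e₀ + q + suc R  ≡⟨ lem₃ e₀ q R ⟩
      (2 + e₀) + (q + suc R) ∎)
      where open ≡-Reasoning

  -- s ≤ V ≤ n - s: write V = t + j s with t = V mod s; non-admissibility of V forces 2 ≤ t and
  -- j < k, and q = t - 1 works, at distances j s + 1 and j s from V.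
  private
    module Middle (V : ℕ) (¬adm-V : ¬ Admissibleₙ V) (s≤V : s ≤ V) (V+s≤n : V + s ≤ n) where

      t : ℕ
      t = V % s
      j : ℕ
      j = V / s

      V≡t+js : V ≡ t + j * s
      V≡t+js = m≡m%n+[m/n]*n V s

      js≤V : j * s ≤ V
      js≤V = subst (j * s ≤_) (sym V≡t+js) (m≤n+m (j * s) t)

      j≥1 : 1 ≤ j
      j≥1 with j ≟ 0
      ... | yes j≡0 = ⊥-elim (<⇒≱ (subst (_< s) (sym (trans V≡t+js (trans (cong (λ x → t + x * s) j≡0) (+-identityʳ t))))
                                           (m%n<n V s)) s≤V)
      ... | no j≢0 = n≢0⇒n>0 j≢0

      j<k : j < k
      j<k with j <? k
      ... | yes j<k = j<k
      ... | no j≮k = ⊥-elim (¬adm-V (mkAdmissible (k ∸ 1) 1 (m+n≤o⇒m≤o∸n 1 k≥2) ≤-refl (m∸n+n≡m (≤-trans (s≤s z≤n) k≥2))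
              (≤-trans (*-monoˡ-≤ s (≤-trans (m∸n≤m k 1) (≮⇒≥ j≮k))) js≤V)
              (subst (λ x → V + x ≤ n) (sym (*-identityˡ s)) V+s≤n)))

      2≤t : 2 ≤ t
      2≤t with 2 ≤? t
      ... | yes 2≤t = 2≤t
      ... | no 2≰t with m≤n⇒∃[o]m+o≡n (<⇒≤ j<k)
      ...   | b , j+b≡k = ⊥-elim (¬adm-V (mkAdmissible j b j≥1 (difference-pos j+b≡k j<k) j+b≡k js≤V
               (subst (_≤ n) (sym (trans (cong (_+ b * s) V≡t+js) (trans (lem t j b s) (cong (λ x → t + x * s) j+b≡k))))
                 (≤-trans (+-monoˡ-≤ (k * s) (≤-pred (≰⇒> 2≰t))) (subst (_≤ n) (+-comm (k * s) 1) k*s+1≤n)))))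
        where
        lem : ∀ t j b s → t + j * s + b * s ≡ t + (j + b) * s
        lem = solve-∀

      obstruction : Obstruction V
      obstruction with m≤n⇒∃[o]m+o≡n 2≤t
      ... | t₀ , 2+t₀≡t = record
        { q = suc t₀
        ; q+1<n = <-≤-trans t<s s≤n
        ; ¬adm-q = ¬admissible-< (<-trans (n<1+n (suc t₀)) t<s)
        ; ¬adm-q+1 = ¬admissible-< t<s
        ; adm-q-V = subst Admissibleₙ (sym (trans (cong (∣ suc t₀ -_∣) V≡1+t₀+[js+1]) (∣m-m+n∣≡n (suc t₀) (j * s + 1))))
                      (admissible-multiple+1 j j≥1 j<k)
        ; adm-q+1-V = subst Admissibleₙ (sym (trans (cong (∣ suc (suc t₀) -_∣) (trans V≡t+js (cong (_+ j * s) (sym 2+t₀≡t))))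
                                                   (∣m-m+n∣≡n (suc (suc t₀)) (j * s))))
                        (admissible-multiple j j≥1 (≤-trans (+-monoˡ-≤ s js≤V) V+s≤n))
        }
        where
        t<s : suc (suc t₀) < s
        t<s = subst (_< s) (sym 2+t₀≡t) (m%n<n V s)
        lem : ∀ t₀ x → 2 + t₀ + x ≡ suc t₀ + (x + 1)
        lem = solve-∀
        V≡1+t₀+[js+1] : V ≡ suc t₀ + (j * s + 1)
        V≡1+t₀+[js+1] = trans V≡t+js (trans (cong (_+ j * s) (sym 2+t₀≡t)) (lem t₀ (j * s)))

  obstruction-middle : ∀ V → ¬ Admissibleₙ V → s ≤ V → V + s ≤ n → Obstruction V
  obstruction-middle = Middle.obstruction

  IndepDiff-0⇒unit : ∀ v → IndepDiff F.zero v → SameCycDist n (toℕ v) 1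
  IndepDiff-0⇒unit v indep with toℕ v ≟ 1 | toℕ v + 1 ≟ n
  ... | yes V≡1 | _ = inj₁ V≡1
  ... | no _ | yes V+1≡n = inj₂ V+1≡n
  ... | no V≢1 | no V+1≢n = ⊥-elim (obstruction⇒¬IndepDiff v obstruction indep)
    where
    V : ℕ
    V = toℕ v
    2≤V : 2 ≤ V
    2≤V = 2≤ V (proj₁ (Adj⇒¬admissible (proj₁ indep)) ∘ FP.toℕ-injective ∘ sym) V≢1
      where
      2≤ : ∀ x → x ≢ 0 → x ≢ 1 → 2 ≤ x
      2≤ zero x≢0 _ = ⊥-elim (x≢0 refl)
      2≤ (suc zero) _ x≢1 = ⊥-elim (x≢1 refl)
      2≤ (suc (suc _)) _ _ = s≤s (s≤s z≤n)
    obstruction : Obstruction V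
    obstruction with V <? s | n <? V + s
    ... | yes V<s | _ = obstruction-near V 2≤V V<s
    ... | no _ | yes n<V+s = obstruction-far V (FP.toℕ<n v) V+1≢n n<V+s
    ... | no V≮s | no n≮V+s = obstruction-middle V (proj₂ (Adj⇒¬admissible (proj₁ indep))) (≮⇒≥ V≮s) (≮⇒≥ n≮V+s)

  module Translation (x : Fin n) where

    X≤n : toℕ x ≤ n
    X≤n = <⇒≤ (FP.toℕ<n x)

    to from : Fin n → Fin n
    to = translate (toℕ x) X≤n
    from = translate (n ∸ toℕ x) (m∸n≤m n (toℕ x))

    from∘to : ∀ y → from (to y) ≡ y
    from∘to = translate-inverse (n ∸ toℕ x) (toℕ x) (m∸n≤m n (toℕ x)) X≤n (m∸n+n≡m X≤n)

    to∘from : ∀ y → to (from y) ≡ y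
    to∘from = translate-inverse (toℕ x) (n ∸ toℕ x) X≤n (m∸n≤m n (toℕ x)) (m+[n∸m]≡n X≤n)

    to-0 : to F.zero ≡ x
    to-0 = FP.toℕ-injective (trans (toℕ-translate (toℕ x) X≤n F.zero) (m<n⇒m%n≡m (FP.toℕ<n x)))

    to-1 : to (F.suc F.zero) ≡ rot x
    to-1 = trans (cong to (sym (rot-point 0 (s≤s (s≤s z≤n))))) (trans (sym (rot-translate (toℕ x) X≤n F.zero)) (cong rot to-0))

    from-x : from x ≡ F.zero
    from-x = trans (cong from (sym to-0)) (from∘to F.zero)

    to-adj : PreservesAdj to
    to-adj = PreservesCycDist⇒Adj⇔ (translate-preserves (toℕ x) X≤n)

    from-adj : PreservesAdj from
    from-adj = PreservesCycDist⇒Adj⇔ (translate-preserves (n ∸ toℕ x) (m∸n≤m n (toℕ x)))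

  CycleEdge⇒IndepDiff : ∀ u v → CycleEdge u v → IndepDiff u v
  CycleEdge⇒IndepDiff u v (inj₁ refl) = subst₂ IndepDiff to-0 to-1
      (IndepDiff-transport to from from∘to to∘from to-adj F.zero (F.suc F.zero) IndepDiff-0-1)
    where open Translation u
  CycleEdge⇒IndepDiff u v (inj₂ refl) = subst₂ IndepDiff to-1 to-0
      (IndepDiff-transport to from from∘to to∘from to-adj (F.suc F.zero) F.zero IndepDiff-1-0)
    where open Translation v

  IndepDiff⇒CycleEdge : ∀ u v → IndepDiff u v → CycleEdge u v
  IndepDiff⇒CycleEdge u v indep = unit⇒CycleEdge u v (SameCycDist-trans
      (SameCycDist-sym (translate-preserves (n ∸ toℕ u) (m∸n≤m n (toℕ u)) u v))
      (subst (λ z → SameCycDist n (dist z (from v)) 1) (sym from-x)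
        (IndepDiff-0⇒unit (from v) (subst (λ z → IndepDiff z (from v)) from-x
          (IndepDiff-transport from to to∘from from∘to from-adj u v indep)))))
    where open Translation u

  automorphism⇒dihedral : (σ : Permutation′ n) → IsAutomorphism n k s σ → Dihedral n (σ ⟨$⟩ʳ_)
  automorphism⇒dihedral σ aut = classify (σ-edge F.zero (F.suc F.zero) (inj₁ refl))
    where
    σ⁺ σ⁻ : Fin n → Fin n
    σ⁺ = σ ⟨$⟩ʳ_
    σ⁻ = σ ⟨$⟩ˡ_
    σ-edge : ∀ u v → CycleEdge u v → CycleEdge (σ⁺ u) (σ⁺ v)
    σ-edge u v e = IndepDiff⇒CycleEdge (σ⁺ u) (σ⁺ v)
      (IndepDiff-transport σ⁺ σ⁻ (λ _ → inverseˡ σ) (λ _ → inverseʳ σ) aut u v (CycleEdge⇒IndepDiff u v e))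
    σ-injective : ∀ {x y} → σ⁺ x ≡ σ⁺ y → x ≡ y
    σ-injective e = trans (sym (inverseˡ σ)) (trans (cong σ⁻ e) (inverseˡ σ))
    open Translation (σ⁺ F.zero)
    classify : CycleEdge (σ⁺ F.zero) (σ⁺ (F.suc F.zero)) → Dihedral n σ⁺
    classify (inj₁ σ1≡rot-σ0) = d-ext (translate∘dihedral (toℕ (σ⁺ F.zero)) X≤n d-id) (sym ∘ σ≗to)
      where
      σ≗to : ∀ x → σ⁺ x ≡ to x
      σ≗to = walk-unique σ⁺ to (λ x y → y ≡ rot x) σ-edge σ-injective (λ _ _ → id)
        (λ e e′ → trans e (sym e′)) (λ e e′ → rot-injective (trans (sym e) e′))
        (λ c c+1<n → trans (cong to (sym (rot-point c c+1<n)))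
                              (sym (rot-translate (toℕ (σ⁺ F.zero)) X≤n (point c (<-trans (n<1+n c) c+1<n)))))
        (sym to-0) (trans σ1≡rot-σ0 (sym to-1))
    classify (inj₂ σ0≡rot-σ1) = d-ext (translate∘dihedral (toℕ (σ⁺ F.zero)) X≤n (d-ref d-id)) (sym ∘ σ≗to∘refl′)
      where
      to∘refl′-walks : ∀ c (c+1<n : suc c < n) →
                       to (refl′ (point c (<-trans (n<1+n c) c+1<n))) ≡ rot (to (refl′ (point (suc c) c+1<n)))
      to∘refl′-walks c c+1<n = trans (cong to (sym (rot-refl′-point c c+1<n)))
                                     (sym (rot-translate (toℕ (σ⁺ F.zero)) X≤n (refl′ (point (suc c) c+1<n))))
      σ0 : σ⁺ F.zero ≡ to (refl′ F.zero)
      σ0 = sym (trans (cong to refl′-0) to-0)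
      σ≗to∘refl′ : ∀ x → σ⁺ x ≡ to (refl′ x)
      σ≗to∘refl′ = walk-unique σ⁺ (to ∘ refl′) (λ x y → x ≡ rot y) σ-edge σ-injective (λ _ _ → [ inj₂ , inj₁ ]′)
        (λ e e′ → rot-injective (trans (sym e) e′)) (λ e e′ → trans e (sym e′))
        to∘refl′-walks σ0 (rot-injective (trans (sym σ0≡rot-σ1) (trans σ0 (to∘refl′-walks 0 (s≤s (s≤s z≤n))))))

  dihedral⇒automorphism : (σ : Permutation′ n) → Dihedral n (σ ⟨$⟩ʳ_) → IsAutomorphism n k s σ
  dihedral⇒automorphism σ d = PreservesCycDist⇒Adj⇔ (Dihedral⇒preserves d)

theorem4 : (n s k : ℕ) → 2 ≤ k → 3 ≤ s → s * k + 1 ≤ n →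
    (σ : Permutation′ n) →
    IsAutomorphism n k s σ ⇔ Dihedral n (σ ⟨$⟩ʳ_)
-- the patterns force s = 3 + s₀ and, since s * k + 1 ≥ 2, n = 2 + m'
theorem4 _ _ k k≥2@(s≤s (s≤s z≤n)) (s≤s (s≤s (s≤s {n = s₀} z≤n))) s*k+1≤n@(s≤s (s≤s {n = m'} _)) σ =
  mk⇔ (automorphism⇒dihedral σ) (dihedral⇒automorphism σ)
  where
  open Automorphisms m' s₀ k k≥2 (subst (λ z → z + 1 ≤ suc (suc m')) (*-comm (suc (suc (suc s₀))) k) s*k+1≤n)
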